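{- \[ 0=\sum_{k=0}^\infty \frac{1}{3^{6k}}\left[\frac{243}{12k+1}-\frac{243}{12k+2}-\frac{324}{12k+3}-\frac{81}{12k+4}+\frac{27}{12k+5}-\frac{9}{12k+7}+\frac{9}{12k+8}+\frac{12}{12k+9}+\frac{3}{12k+10}-\frac{1}{12k+11}\right]. \] -}

module Defs where

open import Data.Nat as ℕ using (ℕ; zero; suc; _≥_)
open import Data.Nat.Properties using (m^n≢0)
open import Data.Integer as ℤ using (ℤ; +_; -[1+_])
open import Data.Rational using (ℚ; 0ℚ; _+_; _-_; _*_; _/_; ∣_∣; _<_)
open import Data.Product using (∃)

-- c / (12k + j), written with denominator j + 12 * k so that it is visibly nonzero
frac : ℤ → ℕ → ℕ → ℚ
frac c j k = c / (suc j ℕ.+ 12 ℕ.* k)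

bracket : ℕ → ℚ
bracket k =
    frac (+ 243) 0 k - frac (+ 243) 1 k - frac (+ 324) 2 k - frac (+ 81) 3 k
  + frac (+ 27) 4 k - frac (+ 9) 6 k + frac (+ 9) 7 k + frac (+ 12) 8 k
  + frac (+ 3) 9 k - frac (+ 1) 10 k

term : ℕ → ℚ
term k = ((+ 1) / (3 ℕ.^ (6 ℕ.* k))) {{m^n≢0 3 (6 ℕ.* k)}} * bracket k

SeriesSumsTo : (ℕ → ℚ) → ℚ → Set
SeriesSumsTo a L = ∀ (ε : ℚ) → 0ℚ < ε → ∃ λ N → ∀ n → n ≥ N → ∣ sums n - L ∣ < ε
  where
    sums : ℕ → ℚ
    sums zero = 0ℚ
    sums (suc n) = sums n + a n

module Submission where

-- In ℚ(√−3) let u = √−3/3, v = −(1 + √−3)/6 and z = √−3/9.  Then (1 + u)(1 + v) = 1 + z,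
-- and (−u)¹², (−z)⁴ and (−v)⁶ all equal 1/729, so grouping the series in blocks of twelve
-- terms shows that its n-th partial sum is 729 times the √−3-coordinate of
-- L₁₂ₙ(u) − L₄ₙ(z) + L₆ₙ(v), where L_N(x) is the N-th partial sum of log (1 + x).
-- The sum vanishes because log (1 + u) + log (1 + v) = log (1 + z).  Without real numbers this
-- is proved for the truncations: for a submultiplicative norm, the function
-- λ ↦ L_N(λu) + L_N(λv) − L_N(w λ), where 1 + w λ = (1 + λu)(1 + λv), vanishes at 0 and its
-- derivative is O((3/4)^N), because L_N′(x) inverts 1 + x up to a geometric tail.  Euler steps
-- of size 1/(M + 1) with second-order Taylor remainders then give
-- ‖L_N(u) + L_N(v) − L_N(z)‖ ≤ 20 (3/4)^N, while the tails of the three series are O((3/4)^N).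

open import Algebra.Bundles using (CommutativeRing)
import Algebra.Properties.Semiring.Exp as Exp
open import Data.List using ([]; _∷_)
open import Data.Integer as ℤ using (+_; +[1+_]; -[1+_])
import Data.Integer.Properties as ℤ
open import Data.Nat as ℕ using (ℕ; zero; suc)
import Data.Nat.Properties as ℕ
import Data.Nat.Tactic.RingSolver as ℕ-Solver
open import Data.Product using (∃; _,_; proj₁; proj₂)
open import Data.Rational as ℚ using (ℚ; mkℚ; 0ℚ; 1ℚ; _+_; _-_; _*_; _/_; -_; ∣_∣; _≤_; _<_)
open import Data.Rational.Properties
open import Data.Rational.Unnormalised as ℚᵘ using (mkℚᵘ)
import Data.Rational.Unnormalised.Properties as ℚᵘ
open import Relation.Binary.PropositionalEquality
open import Relation.Nullary using (Dec; yes; no; contradiction)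
open import Relation.Nullary.Decidable using (True; toWitness; dec⇒maybe)
open import Tactic.RingSolver using (solve)
open import Tactic.RingSolver.Core.AlmostCommutativeRing using (AlmostCommutativeRing; fromCommutativeRing)

open import Defs

cong₃ : ∀ {A B C D : Set} (f : A → B → C → D) {x y z x′ y′ z′} → x ≡ x′ → y ≡ y′ → z ≡ z′ → f x y z ≡ f x′ y′ z′
cong₃ f refl refl refl = refl

ℚ-ring : AlmostCommutativeRing _ _
ℚ-ring = fromCommutativeRing +-*-commutativeRing (λ x → dec⇒maybe (0ℚ ≟ x))

open Exp (CommutativeRing.semiring +-*-commutativeRing) using (_^_; ^-homo-*)

≤-decide : ∀ p q → {True (p ≤? q)} → p ≤ q
≤-decide p q {p≤q} = toWitness p≤q

*-mono-≤-nonNeg : ∀ {p q r s} → 0ℚ ≤ p → 0ℚ ≤ r → p ≤ q → r ≤ s → p * r ≤ q * s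
*-mono-≤-nonNeg {p} {q} {r} {s} 0≤p 0≤r p≤q r≤s = ≤-trans
  (*-monoʳ-≤-nonNeg r {{ℚ.nonNegative 0≤r}} p≤q)
  (*-monoˡ-≤-nonNeg q {{ℚ.nonNegative (≤-trans 0≤p p≤q)}} r≤s)

*-nonNeg : ∀ {p q} → 0ℚ ≤ p → 0ℚ ≤ q → 0ℚ ≤ p * q
*-nonNeg {p} {q} 0≤p 0≤q =
  subst (_≤ p * q) (*-zeroˡ q) (*-mono-≤-nonNeg ≤-refl 0≤q 0≤p ≤-refl)

+-nonNeg : ∀ {p q} → 0ℚ ≤ p → 0ℚ ≤ q → 0ℚ ≤ p + q
+-nonNeg = +-mono-≤

≤-+ʳ : ∀ {p q} → 0ℚ ≤ q → p ≤ p + q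
≤-+ʳ {p} {q} 0≤q = subst (_≤ p + q) (+-identityʳ p) (+-monoʳ-≤ p 0≤q)

*-≤-of-≤-1 : ∀ {p q} → 0ℚ ≤ q → p ≤ 1ℚ → p * q ≤ q
*-≤-of-≤-1 {p} {q} 0≤q p≤1 =
  subst (p * q ≤_) (*-identityˡ q) (*-monoʳ-≤-nonNeg q {{ℚ.nonNegative 0≤q}} p≤1)

1-nonNeg : ∀ {p} → p ≤ 1ℚ → 0ℚ ≤ 1ℚ - p
1-nonNeg p≤1 = +-monoʳ-≤ 1ℚ (neg-antimono-≤ p≤1)

1-≤-1 : ∀ {p} → 0ℚ ≤ p → 1ℚ - p ≤ 1ℚ
1-≤-1 0≤p = +-monoʳ-≤ 1ℚ (neg-antimono-≤ 0≤p)

≤-via-factor : ∀ {X U B} → 0ℚ ≤ X → 0ℚ ≤ B → X * U ≤ 1ℚ → 1ℚ ≤ B * U → X ≤ B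
≤-via-factor {X} {U} {B} 0≤X 0≤B XU≤1 1≤BU = begin
  X             ≡⟨ sym (*-identityʳ X) ⟩
  X * 1ℚ        ≤⟨ *-monoˡ-≤-nonNeg X {{ℚ.nonNegative 0≤X}} 1≤BU ⟩
  X * (B * U)   ≡⟨ solve (X ∷ B ∷ U ∷ []) ℚ-ring ⟩
  B * (X * U)   ≤⟨ *-monoˡ-≤-nonNeg B {{ℚ.nonNegative 0≤B}} XU≤1 ⟩
  B * 1ℚ        ≡⟨ *-identityʳ B ⟩
  B             ∎
  where open ≤-Reasoning

fromℕ : ℕ → ℚ
fromℕ n = + n / 1

infix 9 1/[1+_]
1/[1+_] : ℕ → ℚ
1/[1+ n ] = + 1 / suc n

/-cross : ∀ a b n m → a ℤ.* + suc m ≡ b ℤ.* + suc n → a / suc n ≡ b / suc m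
/-cross a b n m eq = fromℚᵘ-cong {mkℚᵘ a n} {mkℚᵘ b m} (ℚᵘ.*≡* eq)

/-* : ∀ a b n m → (a / suc n) * (b / suc m) ≡ (a ℤ.* b) / (suc n ℕ.* suc m)
/-* a b n m = toℚᵘ-injective (ℚᵘ.≃-trans (toℚᵘ-homo-* (a / suc n) (b / suc m))
  (ℚᵘ.≃-trans (ℚᵘ.*-cong (toℚᵘ-fromℚᵘ (mkℚᵘ a n)) (toℚᵘ-fromℚᵘ (mkℚᵘ b m)))
    (ℚᵘ.≃-sym (toℚᵘ-fromℚᵘ (mkℚᵘ (a ℤ.* b) (ℕ.pred (suc n ℕ.* suc m)))))))

/-+ : ∀ a b n m → a / suc n + b / suc m ≡ (a ℤ.* + suc m ℤ.+ b ℤ.* + suc n) / (suc n ℕ.* suc m)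
/-+ a b n m = toℚᵘ-injective (ℚᵘ.≃-trans (toℚᵘ-homo-+ (a / suc n) (b / suc m))
  (ℚᵘ.≃-trans (ℚᵘ.+-cong (toℚᵘ-fromℚᵘ (mkℚᵘ a n)) (toℚᵘ-fromℚᵘ (mkℚᵘ b m)))
    (ℚᵘ.≃-sym (toℚᵘ-fromℚᵘ (mkℚᵘ (a ℤ.* + suc m ℤ.+ b ℤ.* + suc n) (ℕ.pred (suc n ℕ.* suc m)))))))

fromℕ-+ : ∀ m n → fromℕ (m ℕ.+ n) ≡ fromℕ m + fromℕ n
fromℕ-+ m n = sym (trans (/-+ (+ m) (+ n) 0 0) (/-cross (+ m ℤ.* + 1 ℤ.+ + n ℤ.* + 1) (+ (m ℕ.+ n)) 0 0 (begin
  (+ m ℤ.* + 1 ℤ.+ + n ℤ.* + 1) ℤ.* + 1 ≡⟨ ℤ.*-identityʳ _ ⟩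
  + m ℤ.* + 1 ℤ.+ + n ℤ.* + 1           ≡⟨ cong₂ ℤ._+_ (ℤ.*-identityʳ (+ m)) (ℤ.*-identityʳ (+ n)) ⟩
  + m ℤ.+ + n                            ≡⟨ ℤ.pos-+ m n ⟨
  + (m ℕ.+ n)                            ≡⟨ ℤ.*-identityʳ _ ⟨
  + (m ℕ.+ n) ℤ.* + 1                    ∎)))
  where open ≡-Reasoning

fromℕ-suc : ∀ n → fromℕ (suc n) ≡ fromℕ n + 1ℚ
fromℕ-suc n = trans (cong fromℕ (ℕ.+-comm 1 n)) (fromℕ-+ n 1)

fromℕ-* : ∀ m n → fromℕ (m ℕ.* n) ≡ fromℕ m * fromℕ n
fromℕ-* m n = sym (trans (/-* (+ m) (+ n) 0 0) (/-cross (+ m ℤ.* + n) (+ (m ℕ.* n)) 0 0 (cong (ℤ._* + 1) (sym (ℤ.pos-* m n)))))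

/-as-* : ∀ c m → + c / suc m ≡ fromℕ c * 1/[1+ m ]
/-as-* c m = sym (trans (/-* (+ c) (+ 1) 0 m) (/-cross (+ c ℤ.* + 1) (+ c) (m ℕ.+ 0) m (begin
  + c ℤ.* + 1 ℤ.* + suc m            ≡⟨ cong (ℤ._* + suc m) (ℤ.*-identityʳ (+ c)) ⟩
  + c ℤ.* + suc m                    ≡⟨ cong (λ k → + c ℤ.* + suc k) (ℕ.+-identityʳ m) ⟨
  + c ℤ.* + suc (m ℕ.+ 0)            ∎)))
  where open ≡-Reasoning

1/[1+n]*[1+n] : ∀ n → 1/[1+ n ] * fromℕ (suc n) ≡ 1ℚ
1/[1+n]*[1+n] n = trans (/-* (+ 1) (+ suc n) n 0) (/-cross (+ 1 ℤ.* + suc n) (+ 1) (n ℕ.* 1) 0 (begin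
  + 1 ℤ.* + suc n ℤ.* + 1     ≡⟨ ℤ.*-identityʳ _ ⟩
  + 1 ℤ.* + suc n             ≡⟨ ℤ.*-identityˡ _ ⟩
  + suc n                     ≡⟨ cong +_ (ℕ.*-identityʳ (suc n)) ⟨
  + (suc n ℕ.* 1)             ≡⟨ ℤ.*-identityˡ _ ⟨
  + 1 ℤ.* + (suc n ℕ.* 1)     ∎))
  where open ≡-Reasoning

1/[1+]-rescale : ∀ t n m → t ℕ.* suc n ≡ suc m → 1/[1+ n ] ≡ fromℕ t * 1/[1+ m ]
1/[1+]-rescale t n m eq = trans (/-cross (+ 1) (+ t) n m (begin
  + 1 ℤ.* + suc m          ≡⟨ ℤ.*-identityˡ _ ⟩
  + suc m                  ≡⟨ cong +_ eq ⟨
  + (t ℕ.* suc n)          ≡⟨ ℤ.pos-* t (suc n) ⟩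
  + t ℤ.* + suc n          ∎)) (/-as-* t m)
  where open ≡-Reasoning

/-mono-≤ : ∀ a b n m → a ℕ.* suc m ℕ.≤ b ℕ.* suc n → + a / suc n ≤ + b / suc m
/-mono-≤ a b n m le = toℚᵘ-cancel-≤
  (ℚᵘ.≤-respʳ-≃ (ℚᵘ.≃-sym (toℚᵘ-fromℚᵘ (mkℚᵘ (+ b) m)))
    (ℚᵘ.≤-respˡ-≃ (ℚᵘ.≃-sym (toℚᵘ-fromℚᵘ (mkℚᵘ (+ a) n)))
      (ℚᵘ.*≤* (subst₂ ℤ._≤_ (ℤ.pos-* a (suc m)) (ℤ.pos-* b (suc n)) (ℤ.+≤+ le)))))

/-mono-< : ∀ a b n m → a ℕ.* suc m ℕ.< b ℕ.* suc n → + a / suc n < + b / suc m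
/-mono-< a b n m lt = toℚᵘ-cancel-<
  (ℚᵘ.<-respʳ-≃ (ℚᵘ.≃-sym (toℚᵘ-fromℚᵘ (mkℚᵘ (+ b) m)))
    (ℚᵘ.<-respˡ-≃ (ℚᵘ.≃-sym (toℚᵘ-fromℚᵘ (mkℚᵘ (+ a) n)))
      (ℚᵘ.*<* (subst₂ ℤ._<_ (ℤ.pos-* a (suc m)) (ℤ.pos-* b (suc n)) (ℤ.+<+ lt)))))

fromℕ-nonNeg : ∀ n → 0ℚ ≤ fromℕ n
fromℕ-nonNeg n = nonNegative⁻¹ (fromℕ n) {{normalize-nonNeg n 1}}

fromℕ-mono-≤ : ∀ {m n} → m ℕ.≤ n → fromℕ m ≤ fromℕ n
fromℕ-mono-≤ {m} {n} m≤n = /-mono-≤ m n 0 0 (ℕ.*-monoˡ-≤ 1 m≤n)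

1/[1+]-nonNeg : ∀ n → 0ℚ ≤ 1/[1+ n ]
1/[1+]-nonNeg n = nonNegative⁻¹ 1/[1+ n ] {{normalize-nonNeg 1 (suc n)}}

1/[1+]-≤-1 : ∀ n → 1/[1+ n ] ≤ 1ℚ
1/[1+]-≤-1 n = /-mono-≤ 1 1 n 0 (ℕ.s≤s ℕ.z≤n)

1/[1+]-antitone : ∀ {m n} → m ℕ.≤ n → 1/[1+ n ] ≤ 1/[1+ m ]
1/[1+]-antitone {m} {n} m≤n = /-mono-≤ 1 1 n m (ℕ.*-monoʳ-≤ 1 (ℕ.s≤s m≤n))

archimedean : ∀ c ε → 0ℚ < ε → ∃ λ M → fromℕ c * 1/[1+ M ] < ε
archimedean c ε@(mkℚ +[1+ a ] b _) 0<ε = M , (begin-strict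
  fromℕ c * 1/[1+ M ]   ≡⟨ /-as-* c M ⟨
  + c / suc M           <⟨ /-mono-< c (suc a) M b c·[1+b]<[1+a]·[1+M] ⟩
  + suc a / suc b       ≡⟨ fromℚᵘ-toℚᵘ ε ⟩
  ε                     ∎)
  where
  open ≤-Reasoning
  M : ℕ
  M = c ℕ.* suc b
  c·[1+b]<[1+a]·[1+M] : c ℕ.* suc b ℕ.< suc a ℕ.* suc M
  c·[1+b]<[1+a]·[1+M] = ℕ.<-≤-trans (ℕ.n<1+n M) (ℕ.m≤n*m (suc M) (suc a))
archimedean c (mkℚ (+ 0) _ _) 0<ε with ℚ.positive 0<ε
... | ()
archimedean c (mkℚ -[1+ _ ] _ _) 0<ε with ℚ.positive 0<ε
... | ()

^-nonNeg : ∀ {s} n → 0ℚ ≤ s → 0ℚ ≤ s ^ n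
^-nonNeg zero    0≤s = ≤-decide 0ℚ 1ℚ
^-nonNeg (suc n) 0≤s = *-nonNeg 0≤s (^-nonNeg n 0≤s)

^-suc-≤ : ∀ {s} n → 0ℚ ≤ s → s ≤ 1ℚ → s ^ suc n ≤ s ^ n
^-suc-≤ n 0≤s s≤1 = *-≤-of-≤-1 (^-nonNeg n 0≤s) s≤1

^-antitoneʳ : ∀ {s m n} → 0ℚ ≤ s → s ≤ 1ℚ → m ℕ.≤ n → s ^ n ≤ s ^ m
^-antitoneʳ {s} {m} {n} 0≤s s≤1 m≤n =
  subst (λ k → s ^ k ≤ s ^ m) (ℕ.m+[n∸m]≡n m≤n) (s^[m+k]≤s^m (n ℕ.∸ m))
  where
  s^[m+k]≤s^m : ∀ k → s ^ (m ℕ.+ k) ≤ s ^ m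
  s^[m+k]≤s^m zero    = ≤-reflexive (cong (s ^_) (ℕ.+-identityʳ m))
  s^[m+k]≤s^m (suc k) = ≤-trans (≤-reflexive (cong (s ^_) (ℕ.+-suc m k)))
                                (≤-trans (^-suc-≤ (m ℕ.+ k) 0≤s s≤1) (s^[m+k]≤s^m k))

≤-of-≤-+-vanishing : ∀ {x a} c → (∀ M → x ≤ a + fromℕ c * 1/[1+ M ]) → x ≤ a
≤-of-≤-+-vanishing {x} {a} c x≤a+c/M with x ≤? a
... | yes x≤a = x≤a
... | no  x≰a = contradiction (≤-<-trans (x≤a+c/M M) a+c/M<x) (<-irrefl refl)
  where
  open ≤-Reasoning
  0<x-a : 0ℚ < x - a
  0<x-a = subst (_< x - a) (+-inverseʳ a) (+-monoˡ-< (- a) (≰⇒> x≰a))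
  M : ℕ
  M = proj₁ (archimedean c (x - a) 0<x-a)
  a+c/M<x : a + fromℕ c * 1/[1+ M ] < x
  a+c/M<x = begin-strict
    a + fromℕ c * 1/[1+ M ]  <⟨ +-monoʳ-< a (proj₂ (archimedean c (x - a) 0<x-a)) ⟩
    a + (x - a)              ≡⟨ solve (a ∷ x ∷ []) ℚ-ring ⟩
    x                        ∎

IncrementBound : (ℚ → ℚ) → ℚ → ℕ → Set
IncrementBound ψ A c = ∀ l h → 0ℚ ≤ l → 0ℚ ≤ h → l + h ≤ 1ℚ → ψ (l + h) ≤ ψ l + h * A + h * h * fromℕ c

gridPoint : ℕ → ℕ → ℚ
gridPoint M j = fromℕ j * 1/[1+ M ]

gridPoint-suc : ∀ M j → gridPoint M (suc j) ≡ gridPoint M j + 1/[1+ M ]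
gridPoint-suc M j = trans (cong (_* 1/[1+ M ]) (fromℕ-suc j)) (distrib (fromℕ j) 1/[1+ M ])
  where
  distrib : ∀ n h → (n + 1ℚ) * h ≡ n * h + h
  distrib n h = solve (n ∷ h ∷ []) ℚ-ring

gridPoint-last : ∀ M → gridPoint M (suc M) ≡ 1ℚ
gridPoint-last M = trans (*-comm (fromℕ (suc M)) 1/[1+ M ]) (1/[1+n]*[1+n] M)

gridPoint-nonNeg : ∀ M j → 0ℚ ≤ gridPoint M j
gridPoint-nonNeg M j = *-nonNeg (fromℕ-nonNeg j) (1/[1+]-nonNeg M)

gridPoint-≤-1 : ∀ M {j} → j ℕ.≤ suc M → gridPoint M j ≤ 1ℚ
gridPoint-≤-1 M j≤1+M = ≤-trans (*-monoʳ-≤-nonNeg 1/[1+ M ] {{ℚ.nonNegative (1/[1+]-nonNeg M)}} (fromℕ-mono-≤ j≤1+M))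
                                (≤-reflexive (gridPoint-last M))

along-grid : ∀ (ψ : ℚ → ℚ) A c → ψ 0ℚ ≤ 0ℚ → IncrementBound ψ A c → ∀ M j → j ℕ.≤ suc M →
             ψ (gridPoint M j) ≤ fromℕ j * (1/[1+ M ] * A + 1/[1+ M ] * 1/[1+ M ] * fromℕ c)
along-grid ψ A c ψ0≤0 step M zero    _      = ≤-trans (≤-reflexive (cong ψ (*-zeroˡ 1/[1+ M ])))
                                                      (≤-trans ψ0≤0 (≤-reflexive (sym (*-zeroˡ (1/[1+ M ] * A + 1/[1+ M ] * 1/[1+ M ] * fromℕ c)))))
along-grid ψ A c ψ0≤0 step M (suc j) j<2+M = begin
  ψ (gridPoint M (suc j))                  ≡⟨ cong ψ (gridPoint-suc M j) ⟩
  ψ (gridPoint M j + h)                    ≤⟨ step (gridPoint M j) h (gridPoint-nonNeg M j) (1/[1+]-nonNeg M)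
                                                (≤-trans (≤-reflexive (sym (gridPoint-suc M j))) (gridPoint-≤-1 M j<2+M)) ⟩
  ψ (gridPoint M j) + h * A + h * h * fromℕ c
    ≤⟨ +-monoˡ-≤ (h * h * fromℕ c) (+-monoˡ-≤ (h * A) (along-grid ψ A c ψ0≤0 step M j (ℕ.≤-trans (ℕ.n≤1+n j) j<2+M))) ⟩
  fromℕ j * (h * A + h * h * fromℕ c) + h * A + h * h * fromℕ c
    ≡⟨ add-one (fromℕ j) (h * A) (h * h * fromℕ c) ⟩
  (fromℕ j + 1ℚ) * (h * A + h * h * fromℕ c)    ≡⟨ cong (_* (h * A + h * h * fromℕ c)) (fromℕ-suc j) ⟨
  fromℕ (suc j) * (h * A + h * h * fromℕ c)     ∎
  where
  open ≤-Reasoning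
  h : ℚ
  h = 1/[1+ M ]
  add-one : ∀ n a b → n * (a + b) + a + b ≡ (n + 1ℚ) * (a + b)
  add-one n a b = solve (n ∷ a ∷ b ∷ []) ℚ-ring

-- Summing the increments along the grid j / (M + 1) bounds ψ 1 by A + c / (M + 1), for every M.
bounded-increments⇒≤ : ∀ (ψ : ℚ → ℚ) A c → ψ 0ℚ ≤ 0ℚ → IncrementBound ψ A c → ψ 1ℚ ≤ A
bounded-increments⇒≤ ψ A c ψ0≤0 step = ≤-of-≤-+-vanishing c λ M → begin
  ψ 1ℚ                                                         ≡⟨ cong ψ (gridPoint-last M) ⟨
  ψ (gridPoint M (suc M))                                      ≤⟨ along-grid ψ A c ψ0≤0 step M (suc M) ℕ.≤-refl ⟩
  fromℕ (suc M) * (1/[1+ M ] * A + 1/[1+ M ] * 1/[1+ M ] * fromℕ c)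
    ≡⟨ telescope (fromℕ (suc M)) 1/[1+ M ] A (fromℕ c) ⟩
  (1/[1+ M ] * fromℕ (suc M)) * A + (1/[1+ M ] * fromℕ (suc M)) * (fromℕ c * 1/[1+ M ])
    ≡⟨ cong (λ t → t * A + t * (fromℕ c * 1/[1+ M ])) (1/[1+n]*[1+n] M) ⟩
  1ℚ * A + 1ℚ * (fromℕ c * 1/[1+ M ])                          ≡⟨ cong₂ _+_ (*-identityˡ A) (*-identityˡ _) ⟩
  A + fromℕ c * 1/[1+ M ]                                      ∎
  where
  open ≤-Reasoning
  telescope : ∀ n h A C → n * (h * A + h * h * C) ≡ (h * n) * A + (h * n) * (C * h)
  telescope n h A C = solve (n ∷ h ∷ A ∷ C ∷ []) ℚ-ring

absorb : ∀ {X Y r B} → 0ℚ ≤ X → 0ℚ ≤ B → X ≤ Y + r * X → 1ℚ ≤ B * (1ℚ - r) → X ≤ B * Y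
absorb {X} {Y} {r} {B} 0≤X 0≤B X≤Y+rX 1≤B[1-r] = begin
  X                   ≡⟨ *-identityʳ X ⟨
  X * 1ℚ              ≤⟨ *-monoˡ-≤-nonNeg X {{ℚ.nonNegative 0≤X}} 1≤B[1-r] ⟩
  X * (B * (1ℚ - r))  ≡⟨ solve (X ∷ B ∷ r ∷ []) ℚ-ring ⟩
  B * (X - r * X)     ≤⟨ *-monoˡ-≤-nonNeg B {{ℚ.nonNegative 0≤B}} (+-monoˡ-≤ (- (r * X)) X≤Y+rX) ⟩
  B * (Y + r * X - r * X) ≡⟨ cong (B *_) (solve (Y ∷ r ∷ X ∷ []) ℚ-ring) ⟩
  B * Y               ∎
  where open ≤-Reasoning

geometric : ℚ → ℕ → ℚ
geometric s zero    = 0ℚ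
geometric s (suc N) = geometric s N + s ^ N

geometric′ : ℚ → ℕ → ℚ
geometric′ s zero    = 0ℚ
geometric′ s (suc N) = geometric′ s N + fromℕ (suc N) * s ^ N

geometric-nonNeg : ∀ {s} N → 0ℚ ≤ s → 0ℚ ≤ geometric s N
geometric-nonNeg zero    0≤s = ≤-refl
geometric-nonNeg (suc N) 0≤s = +-nonNeg (geometric-nonNeg N 0≤s) (^-nonNeg N 0≤s)

geometric′-nonNeg : ∀ {s} N → 0ℚ ≤ s → 0ℚ ≤ geometric′ s N
geometric′-nonNeg zero    0≤s = ≤-refl
geometric′-nonNeg (suc N) 0≤s =
  +-nonNeg (geometric′-nonNeg N 0≤s) (*-nonNeg (fromℕ-nonNeg (suc N)) (^-nonNeg N 0≤s))

geometric-closed : ∀ s N → geometric s N * (1ℚ - s) ≡ 1ℚ - s ^ N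
geometric-closed s zero    = solve (s ∷ []) ℚ-ring
geometric-closed s (suc N) = step (geometric s N) (s ^ N) (geometric-closed s N)
  where
  open ≡-Reasoning
  step : ∀ G P → G * (1ℚ - s) ≡ 1ℚ - P → (G + P) * (1ℚ - s) ≡ 1ℚ - s * P
  step G P eq = begin
    (G + P) * (1ℚ - s)          ≡⟨ solve (G ∷ P ∷ s ∷ []) ℚ-ring ⟩
    G * (1ℚ - s) + P * (1ℚ - s) ≡⟨ cong (_+ P * (1ℚ - s)) eq ⟩
    1ℚ - P + P * (1ℚ - s)       ≡⟨ solve (P ∷ s ∷ []) ℚ-ring ⟩
    1ℚ - s * P                  ∎

geometric′-closed : ∀ s N → geometric′ s N * ((1ℚ - s) * (1ℚ - s)) ≡ 1ℚ - s ^ N * (1ℚ + fromℕ N * (1ℚ - s))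
geometric′-closed s zero    = solve (s ∷ []) ℚ-ring
geometric′-closed s (suc N) = begin
  (geometric′ s N + fromℕ (suc N) * s ^ N) * U
    ≡⟨ cong (λ m → (geometric′ s N + m * s ^ N) * U) (fromℕ-suc N) ⟩
  (geometric′ s N + (fromℕ N + 1ℚ) * s ^ N) * U
    ≡⟨ step (geometric′ s N) (fromℕ N) (s ^ N) (geometric′-closed s N) ⟩
  1ℚ - s * s ^ N * (1ℚ + (fromℕ N + 1ℚ) * (1ℚ - s))
    ≡⟨ cong (λ m → 1ℚ - s * s ^ N * (1ℚ + m * (1ℚ - s))) (fromℕ-suc N) ⟨
  1ℚ - s ^ suc N * (1ℚ + fromℕ (suc N) * (1ℚ - s))
    ∎
  where
  open ≡-Reasoning
  U : ℚ
  U = (1ℚ - s) * (1ℚ - s)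
  step : ∀ G n P → G * ((1ℚ - s) * (1ℚ - s)) ≡ 1ℚ - P * (1ℚ + n * (1ℚ - s)) →
         (G + (n + 1ℚ) * P) * ((1ℚ - s) * (1ℚ - s)) ≡ 1ℚ - s * P * (1ℚ + (n + 1ℚ) * (1ℚ - s))
  step G n P eq = begin
    (G + (n + 1ℚ) * P) * ((1ℚ - s) * (1ℚ - s))
      ≡⟨ solve (G ∷ n ∷ P ∷ s ∷ []) ℚ-ring ⟩
    G * ((1ℚ - s) * (1ℚ - s)) + (n + 1ℚ) * P * ((1ℚ - s) * (1ℚ - s))
      ≡⟨ cong (_+ (n + 1ℚ) * P * ((1ℚ - s) * (1ℚ - s))) eq ⟩
    1ℚ - P * (1ℚ + n * (1ℚ - s)) + (n + 1ℚ) * P * ((1ℚ - s) * (1ℚ - s))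
      ≡⟨ solve (P ∷ n ∷ s ∷ []) ℚ-ring ⟩
    1ℚ - s * P * (1ℚ + (n + 1ℚ) * (1ℚ - s))
      ∎

geometric-≤ : ∀ {s B} N → 0ℚ ≤ s → s ≤ 1ℚ → 0ℚ ≤ B → 1ℚ ≤ B * (1ℚ - s) → geometric s N ≤ B
geometric-≤ {s} N 0≤s s≤1 0≤B 1≤B[1-s] = ≤-via-factor (geometric-nonNeg N 0≤s) 0≤B
  (≤-trans (≤-reflexive (geometric-closed s N)) (1-≤-1 (^-nonNeg N 0≤s))) 1≤B[1-s]

geometric′-≤ : ∀ {s B} N → 0ℚ ≤ s → s ≤ 1ℚ → 0ℚ ≤ B → 1ℚ ≤ B * ((1ℚ - s) * (1ℚ - s)) → geometric′ s N ≤ B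
geometric′-≤ {s} N 0≤s s≤1 0≤B 1≤B[1-s]² = ≤-via-factor (geometric′-nonNeg N 0≤s) 0≤B
  (≤-trans (≤-reflexive (geometric′-closed s N))
    (1-≤-1 (*-nonNeg (^-nonNeg N 0≤s) (+-nonNeg (≤-decide 0ℚ 1ℚ) (*-nonNeg (fromℕ-nonNeg N) (1-nonNeg s≤1))))))
  1≤B[1-s]²

-- mk a b represents a + b√−3.  Without η, _⊕_ and _⊗_ compute by matching on mk, so their
-- components reach the ring solver unfolded instead of as opaque projections.
record ℚ[√-3] : Set where
  no-eta-equality
  pattern
  constructor mk
  field
    re im : ℚ

open ℚ[√-3]

infixl 6 _⊕_
infixl 7 _⊗_
infix  8 ⊖_

_⊕_ : ℚ[√-3] → ℚ[√-3] → ℚ[√-3]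
mk a b ⊕ mk c d = mk (a + c) (b + d)

_⊗_ : ℚ[√-3] → ℚ[√-3] → ℚ[√-3]
mk a b ⊗ mk c d = mk (a * c - fromℕ 3 * (b * d)) (a * d + b * c)

⊖_ : ℚ[√-3] → ℚ[√-3]
⊖ mk a b = mk (- a) (- b)

𝟘 𝟙 : ℚ[√-3]
𝟘 = mk 0ℚ 0ℚ
𝟙 = mk 1ℚ 0ℚ

ι : ℚ → ℚ[√-3]
ι q = mk q 0ℚ

ℚ[√-3]-commutativeRing : CommutativeRing _ _
ℚ[√-3]-commutativeRing = record
  { Carrier = ℚ[√-3] ; _≈_ = _≡_ ; _+_ = _⊕_ ; _*_ = _⊗_ ; -_ = ⊖_ ; 0# = 𝟘 ; 1# = 𝟙
  ; isCommutativeRing = record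
    { isRing = record
      { +-isAbelianGroup = record
        { isGroup = record
          { isMonoid = record
            { isSemigroup = record
              { isMagma = record { isEquivalence = isEquivalence ; ∙-cong = cong₂ _⊕_ }
              ; assoc = ⊕-assoc }
            ; identity = ⊕-identityˡ , ⊕-identityʳ }
          ; inverse = ⊖-inverseˡ , ⊖-inverseʳ
          ; ⁻¹-cong = cong ⊖_ }
        ; comm = ⊕-comm }
      ; *-cong = cong₂ _⊗_
      ; *-assoc = ⊗-assoc
      ; *-identity = ⊗-identityˡ , ⊗-identityʳ
      ; distrib = ⊗-distribˡ-⊕ , ⊗-distribʳ-⊕ }
    ; *-comm = ⊗-comm } }
  where
  ⊕-assoc : ∀ x y z → (x ⊕ y) ⊕ z ≡ x ⊕ (y ⊕ z)
  ⊕-assoc (mk a b) (mk c d) (mk e f) = cong₂ mk (+-assoc a c e) (+-assoc b d f)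

  ⊕-comm : ∀ x y → x ⊕ y ≡ y ⊕ x
  ⊕-comm (mk a b) (mk c d) = cong₂ mk (+-comm a c) (+-comm b d)

  ⊕-identityˡ : ∀ x → 𝟘 ⊕ x ≡ x
  ⊕-identityˡ (mk a b) = cong₂ mk (+-identityˡ a) (+-identityˡ b)

  ⊕-identityʳ : ∀ x → x ⊕ 𝟘 ≡ x
  ⊕-identityʳ (mk a b) = cong₂ mk (+-identityʳ a) (+-identityʳ b)

  ⊖-inverseˡ : ∀ x → ⊖ x ⊕ x ≡ 𝟘
  ⊖-inverseˡ (mk a b) = cong₂ mk (+-inverseˡ a) (+-inverseˡ b)

  ⊖-inverseʳ : ∀ x → x ⊕ ⊖ x ≡ 𝟘
  ⊖-inverseʳ (mk a b) = cong₂ mk (+-inverseʳ a) (+-inverseʳ b)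

  ⊗-assoc : ∀ x y z → (x ⊗ y) ⊗ z ≡ x ⊗ (y ⊗ z)
  ⊗-assoc (mk a b) (mk c d) (mk e f) =
    cong₂ mk (solve (a ∷ b ∷ c ∷ d ∷ e ∷ f ∷ []) ℚ-ring) (solve (a ∷ b ∷ c ∷ d ∷ e ∷ f ∷ []) ℚ-ring)

  ⊗-comm : ∀ x y → x ⊗ y ≡ y ⊗ x
  ⊗-comm (mk a b) (mk c d) = cong₂ mk (solve (a ∷ b ∷ c ∷ d ∷ []) ℚ-ring) (solve (a ∷ b ∷ c ∷ d ∷ []) ℚ-ring)

  ⊗-identityˡ : ∀ x → 𝟙 ⊗ x ≡ x
  ⊗-identityˡ (mk a b) = cong₂ mk (solve (a ∷ b ∷ []) ℚ-ring) (solve (a ∷ b ∷ []) ℚ-ring)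

  ⊗-identityʳ : ∀ x → x ⊗ 𝟙 ≡ x
  ⊗-identityʳ x = trans (⊗-comm x 𝟙) (⊗-identityˡ x)

  ⊗-distribˡ-⊕ : ∀ x y z → x ⊗ (y ⊕ z) ≡ x ⊗ y ⊕ x ⊗ z
  ⊗-distribˡ-⊕ (mk a b) (mk c d) (mk e f) =
    cong₂ mk (solve (a ∷ b ∷ c ∷ d ∷ e ∷ f ∷ []) ℚ-ring) (solve (a ∷ b ∷ c ∷ d ∷ e ∷ f ∷ []) ℚ-ring)

  ⊗-distribʳ-⊕ : ∀ x y z → (y ⊕ z) ⊗ x ≡ y ⊗ x ⊕ z ⊗ x
  ⊗-distribʳ-⊕ (mk a b) (mk c d) (mk e f) =
    cong₂ mk (solve (a ∷ b ∷ c ∷ d ∷ e ∷ f ∷ []) ℚ-ring) (solve (a ∷ b ∷ c ∷ d ∷ e ∷ f ∷ []) ℚ-ring)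

_≟ᴷ_ : (x y : ℚ[√-3]) → Dec (x ≡ y)
mk a b ≟ᴷ mk c d with a ≟ c | b ≟ d
... | yes refl | yes refl = yes refl
... | no a≢c   | _        = no (λ eq → a≢c (cong re eq))
... | _        | no b≢d   = no (λ eq → b≢d (cong im eq))

ℚ[√-3]-ring : AlmostCommutativeRing _ _
ℚ[√-3]-ring = fromCommutativeRing ℚ[√-3]-commutativeRing (λ x → dec⇒maybe (𝟘 ≟ᴷ x))

open CommutativeRing ℚ[√-3]-commutativeRing using ()
  renaming (-‿inverseʳ to ⊖-inverseʳ; +-identityʳ to ⊕-identityʳ; +-assoc to ⊕-assoc; *-comm to ⊗-comm)

open Exp (CommutativeRing.semiring ℚ[√-3]-commutativeRing) using ()
  renaming (_^_ to _^ᴷ_; ^-homo-* to ^ᴷ-homo-*; ^-assocʳ to ^ᴷ-assocʳ)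

ι-⊗ : ∀ s x → ι s ⊗ x ≡ mk (s * re x) (s * im x)
ι-⊗ s (mk a b) = cong₂ mk (solve (s ∷ a ∷ b ∷ []) ℚ-ring) (solve (s ∷ a ∷ b ∷ []) ℚ-ring)

ι-homo-* : ∀ s t → ι s ⊗ ι t ≡ ι (s * t)
ι-homo-* s t = trans (ι-⊗ s (ι t)) (cong (mk (s * t)) (*-zeroʳ s))

ι-homo-+ : ∀ s t → ι s ⊕ ι t ≡ ι (s + t)
ι-homo-+ s t = refl

√3⁺ : ℚ
√3⁺ = + 7 / 4

-- A weighted ℓ¹ norm; the weight √3⁺ ≥ √3 is what makes it submultiplicative.
‖_‖ : ℚ[√-3] → ℚ
‖ mk a b ‖ = ∣ a ∣ + √3⁺ * ∣ b ∣

‖‖-nonNeg : ∀ x → 0ℚ ≤ ‖ x ‖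
‖‖-nonNeg (mk a b) = +-nonNeg (0≤∣p∣ a) (*-nonNeg (≤-decide 0ℚ √3⁺) (0≤∣p∣ b))

‖‖-⊖ : ∀ x → ‖ ⊖ x ‖ ≡ ‖ x ‖
‖‖-⊖ (mk a b) = cong₂ (λ p q → p + √3⁺ * q) (∣-p∣≡∣p∣ a) (∣-p∣≡∣p∣ b)

‖‖-triangle : ∀ x y → ‖ x ⊕ y ‖ ≤ ‖ x ‖ + ‖ y ‖
‖‖-triangle (mk a b) (mk c d) = begin
  ∣ a + c ∣ + √3⁺ * ∣ b + d ∣
    ≤⟨ +-mono-≤ (∣p+q∣≤∣p∣+∣q∣ a c) (*-monoˡ-≤-nonNeg √3⁺ (∣p+q∣≤∣p∣+∣q∣ b d)) ⟩
  (∣ a ∣ + ∣ c ∣) + √3⁺ * (∣ b ∣ + ∣ d ∣)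
    ≡⟨ regroup (∣ a ∣) (∣ b ∣) (∣ c ∣) (∣ d ∣) ⟩
  (∣ a ∣ + √3⁺ * ∣ b ∣) + (∣ c ∣ + √3⁺ * ∣ d ∣)
    ∎
  where
  open ≤-Reasoning
  regroup : ∀ A B C D → (A + C) + √3⁺ * (B + D) ≡ (A + √3⁺ * B) + (C + √3⁺ * D)
  regroup A B C D = solve (A ∷ B ∷ C ∷ D ∷ []) ℚ-ring

‖‖-submultiplicative : ∀ x y → ‖ x ⊗ y ‖ ≤ ‖ x ‖ * ‖ y ‖
‖‖-submultiplicative (mk a b) (mk c d) = begin
  ∣ a * c - fromℕ 3 * (b * d) ∣ + √3⁺ * ∣ a * d + b * c ∣
    ≤⟨ +-mono-≤ (∣p-q∣≤∣p∣+∣q∣ (a * c) (fromℕ 3 * (b * d)))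
                (*-monoˡ-≤-nonNeg √3⁺ (∣p+q∣≤∣p∣+∣q∣ (a * d) (b * c))) ⟩
  (∣ a * c ∣ + ∣ fromℕ 3 * (b * d) ∣) + √3⁺ * (∣ a * d ∣ + ∣ b * c ∣)
    ≡⟨ cong₂ (λ p q → p + √3⁺ * q)
         (cong₂ _+_ (∣p*q∣≡∣p∣*∣q∣ a c)
                    (trans (∣p*q∣≡∣p∣*∣q∣ (fromℕ 3) (b * d)) (cong (fromℕ 3 *_) (∣p*q∣≡∣p∣*∣q∣ b d))))
         (cong₂ _+_ (∣p*q∣≡∣p∣*∣q∣ a d) (∣p*q∣≡∣p∣*∣q∣ b c)) ⟩
  (A * C + fromℕ 3 * (B * D)) + √3⁺ * (A * D + B * C)
    ≤⟨ +-monoˡ-≤ (√3⁺ * (A * D + B * C)) (+-monoʳ-≤ (A * C)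
         (*-monoʳ-≤-nonNeg (B * D) {{ℚ.nonNegative (*-nonNeg (0≤∣p∣ b) (0≤∣p∣ d))}} 3≤√3⁺²)) ⟩
  (A * C + (√3⁺ * √3⁺) * (B * D)) + √3⁺ * (A * D + B * C)
    ≡⟨ factor A B C D ⟩
  (A + √3⁺ * B) * (C + √3⁺ * D)
    ∎
  where
  open ≤-Reasoning
  A B C D : ℚ
  A = ∣ a ∣
  B = ∣ b ∣
  C = ∣ c ∣
  D = ∣ d ∣
  3≤√3⁺² : fromℕ 3 ≤ √3⁺ * √3⁺
  3≤√3⁺² = ≤-decide (fromℕ 3) (√3⁺ * √3⁺)
  factor : ∀ A B C D → (A * C + (√3⁺ * √3⁺) * (B * D)) + √3⁺ * (A * D + B * C) ≡ (A + √3⁺ * B) * (C + √3⁺ * D)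
  factor A B C D = solve (A ∷ B ∷ C ∷ D ∷ []) ℚ-ring

‖ι⊗‖ : ∀ s x → 0ℚ ≤ s → ‖ ι s ⊗ x ‖ ≡ s * ‖ x ‖
‖ι⊗‖ s x@(mk a b) 0≤s = begin
  ‖ ι s ⊗ x ‖                          ≡⟨ cong ‖_‖ (ι-⊗ s x) ⟩
  ∣ s * a ∣ + √3⁺ * ∣ s * b ∣          ≡⟨ cong₂ (λ p q → p + √3⁺ * q) (∣p*q∣≡∣p∣*∣q∣ s a) (∣p*q∣≡∣p∣*∣q∣ s b) ⟩
  ∣ s ∣ * ∣ a ∣ + √3⁺ * (∣ s ∣ * ∣ b ∣) ≡⟨ cong (λ t → t * ∣ a ∣ + √3⁺ * (t * ∣ b ∣)) (0≤p⇒∣p∣≡p 0≤s) ⟩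
  s * ∣ a ∣ + √3⁺ * (s * ∣ b ∣)        ≡⟨ factor s (∣ a ∣) (∣ b ∣) ⟩
  s * ‖ x ‖                            ∎
  where
  open ≡-Reasoning
  factor : ∀ s A B → s * A + √3⁺ * (s * B) ≡ s * (A + √3⁺ * B)
  factor s A B = solve (s ∷ A ∷ B ∷ []) ℚ-ring

‖⊖‖-≤ : ∀ x {c} → ‖ x ‖ ≤ c → ‖ ⊖ x ‖ ≤ c
‖⊖‖-≤ x = subst (_≤ _) (sym (‖‖-⊖ x))

‖⊗‖-≤ : ∀ x y {X Y} → ‖ x ‖ ≤ X → ‖ y ‖ ≤ Y → ‖ x ⊗ y ‖ ≤ X * Y
‖⊗‖-≤ x y ‖x‖≤X ‖y‖≤Y =
  ≤-trans (‖‖-submultiplicative x y) (*-mono-≤-nonNeg (‖‖-nonNeg x) (‖‖-nonNeg y) ‖x‖≤X ‖y‖≤Y)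

‖⊕‖-≤ : ∀ x y {X Y} → ‖ x ‖ ≤ X → ‖ y ‖ ≤ Y → ‖ x ⊕ y ‖ ≤ X + Y
‖⊕‖-≤ x y ‖x‖≤X ‖y‖≤Y = ≤-trans (‖‖-triangle x y) (+-mono-≤ ‖x‖≤X ‖y‖≤Y)

‖^ᴷ‖-≤ : ∀ x {s} n → ‖ x ‖ ≤ s → ‖ x ^ᴷ n ‖ ≤ s ^ n
‖^ᴷ‖-≤ x zero    ‖x‖≤s = ≤-refl
‖^ᴷ‖-≤ x (suc n) ‖x‖≤s = ‖⊗‖-≤ x (x ^ᴷ n) ‖x‖≤s (‖^ᴷ‖-≤ x n ‖x‖≤s)

∣im∣-≤ : ∀ x → ∣ im x ∣ ≤ + 4 / 7 * ‖ x ‖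
∣im∣-≤ (mk a b) = begin
  ∣ b ∣                                 ≡⟨ *-identityˡ (∣ b ∣) ⟨
  (+ 4 / 7 * √3⁺) * ∣ b ∣               ≡⟨ *-assoc (+ 4 / 7) √3⁺ (∣ b ∣) ⟩
  + 4 / 7 * (√3⁺ * ∣ b ∣)               ≤⟨ *-monoˡ-≤-nonNeg (+ 4 / 7) (≤-trans (≤-reflexive (sym (+-identityˡ (√3⁺ * ∣ b ∣))))
                                            (+-monoˡ-≤ (√3⁺ * ∣ b ∣) (0≤∣p∣ a))) ⟩
  + 4 / 7 * (∣ a ∣ + √3⁺ * ∣ b ∣)       ∎
  where open ≤-Reasoning

‖ι⊗‖-≤-scaled : ∀ {h c} x → 0ℚ ≤ h → ‖ x ‖ ≤ c → ‖ ι h ⊗ x ‖ ≤ h * c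
‖ι⊗‖-≤-scaled {h} x 0≤h ‖x‖≤c = ≤-trans (≤-reflexive (‖ι⊗‖ h x 0≤h)) (*-monoˡ-≤-nonNeg h {{ℚ.nonNegative 0≤h}} ‖x‖≤c)

logTerm : ℕ → ℚ[√-3] → ℚ[√-3]
logTerm n x = ⊖ (ι 1/[1+ n ] ⊗ (⊖ x) ^ᴷ suc n)

log₁₊ : ℕ → ℚ[√-3] → ℚ[√-3]
log₁₊ zero    x = 𝟘
log₁₊ (suc N) x = log₁₊ N x ⊕ logTerm N x

log₁₊′ : ℕ → ℚ[√-3] → ℚ[√-3]
log₁₊′ zero    x = 𝟘
log₁₊′ (suc N) x = log₁₊′ N x ⊕ (⊖ x) ^ᴷ N

log₁₊′-closed : ∀ N x → (𝟙 ⊕ x) ⊗ log₁₊′ N x ≡ 𝟙 ⊕ ⊖ ((⊖ x) ^ᴷ N)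
log₁₊′-closed zero    x = solve (x ∷ []) ℚ[√-3]-ring
log₁₊′-closed (suc N) x = step (log₁₊′ N x) ((⊖ x) ^ᴷ N) (log₁₊′-closed N x)
  where
  open ≡-Reasoning
  step : ∀ D P → (𝟙 ⊕ x) ⊗ D ≡ 𝟙 ⊕ ⊖ P → (𝟙 ⊕ x) ⊗ (D ⊕ P) ≡ 𝟙 ⊕ ⊖ ((⊖ x) ⊗ P)
  step D P eq = begin
    (𝟙 ⊕ x) ⊗ (D ⊕ P)           ≡⟨ solve (x ∷ D ∷ P ∷ []) ℚ[√-3]-ring ⟩
    (𝟙 ⊕ x) ⊗ D ⊕ (𝟙 ⊕ x) ⊗ P   ≡⟨ cong (_⊕ (𝟙 ⊕ x) ⊗ P) eq ⟩
    𝟙 ⊕ ⊖ P ⊕ (𝟙 ⊕ x) ⊗ P       ≡⟨ solve (x ∷ P ∷ []) ℚ[√-3]-ring ⟩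
    𝟙 ⊕ ⊖ ((⊖ x) ⊗ P)           ∎

log₁₊-zero : ∀ N → log₁₊ N 𝟘 ≡ 𝟘
log₁₊-zero zero    = refl
log₁₊-zero (suc N) = trans (cong (_⊕ logTerm N 𝟘) (log₁₊-zero N)) (vanish (ι 1/[1+ N ]) (𝟘 ^ᴷ N))
  where
  vanish : ∀ c P → 𝟘 ⊕ ⊖ (c ⊗ (⊖ 𝟘 ⊗ P)) ≡ 𝟘
  vanish c P = solve (c ∷ P ∷ []) ℚ[√-3]-ring

‖logTerm‖-≤ : ∀ n x {s} → 0ℚ ≤ s → s ≤ 1ℚ → ‖ x ‖ ≤ s → ‖ logTerm n x ‖ ≤ s ^ n
‖logTerm‖-≤ n x {s} 0≤s s≤1 ‖x‖≤s = begin
  ‖ logTerm n x ‖                              ≡⟨ ‖‖-⊖ (ι 1/[1+ n ] ⊗ (⊖ x) ^ᴷ suc n) ⟩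
  ‖ ι 1/[1+ n ] ⊗ (⊖ x) ^ᴷ suc n ‖             ≡⟨ ‖ι⊗‖ 1/[1+ n ] ((⊖ x) ^ᴷ suc n) (1/[1+]-nonNeg n) ⟩
  1/[1+ n ] * ‖ (⊖ x) ^ᴷ suc n ‖               ≤⟨ *-≤-of-≤-1 (‖‖-nonNeg ((⊖ x) ^ᴷ suc n)) (1/[1+]-≤-1 n) ⟩
  ‖ (⊖ x) ^ᴷ suc n ‖                           ≤⟨ ‖^ᴷ‖-≤ (⊖ x) (suc n) (‖⊖‖-≤ x ‖x‖≤s) ⟩
  s ^ suc n                                    ≤⟨ ^-suc-≤ n 0≤s s≤1 ⟩
  s ^ n                                        ∎
  where open ≤-Reasoning

log₁₊-tail-≤ : ∀ N k x {s} → 0ℚ ≤ s → s ≤ 1ℚ → ‖ x ‖ ≤ s →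
               ‖ log₁₊ (N ℕ.+ k) x ⊕ ⊖ log₁₊ N x ‖ ≤ s ^ N * geometric s k
log₁₊-tail-≤ N zero x {s} 0≤s s≤1 ‖x‖≤s = begin
  ‖ log₁₊ (N ℕ.+ 0) x ⊕ ⊖ log₁₊ N x ‖  ≡⟨ cong (λ n → ‖ log₁₊ n x ⊕ ⊖ log₁₊ N x ‖) (ℕ.+-identityʳ N) ⟩
  ‖ log₁₊ N x ⊕ ⊖ log₁₊ N x ‖          ≡⟨ cong ‖_‖ (⊖-inverseʳ (log₁₊ N x)) ⟩
  0ℚ                                   ≡⟨ *-zeroʳ (s ^ N) ⟨
  s ^ N * 0ℚ                           ∎
  where open ≤-Reasoning
log₁₊-tail-≤ N (suc k) x {s} 0≤s s≤1 ‖x‖≤s = begin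
  ‖ log₁₊ (N ℕ.+ suc k) x ⊕ ⊖ log₁₊ N x ‖
    ≡⟨ cong (λ n → ‖ log₁₊ n x ⊕ ⊖ log₁₊ N x ‖) (ℕ.+-suc N k) ⟩
  ‖ log₁₊ (N ℕ.+ k) x ⊕ logTerm (N ℕ.+ k) x ⊕ ⊖ log₁₊ N x ‖
    ≡⟨ cong ‖_‖ (swap (log₁₊ (N ℕ.+ k) x) (logTerm (N ℕ.+ k) x) (log₁₊ N x)) ⟩
  ‖ (log₁₊ (N ℕ.+ k) x ⊕ ⊖ log₁₊ N x) ⊕ logTerm (N ℕ.+ k) x ‖
    ≤⟨ ‖⊕‖-≤ (log₁₊ (N ℕ.+ k) x ⊕ ⊖ log₁₊ N x) (logTerm (N ℕ.+ k) x) (log₁₊-tail-≤ N k x 0≤s s≤1 ‖x‖≤s) (‖logTerm‖-≤ (N ℕ.+ k) x 0≤s s≤1 ‖x‖≤s) ⟩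
  s ^ N * geometric s k + s ^ (N ℕ.+ k)
    ≡⟨ cong (λ t → s ^ N * geometric s k + t) (^-homo-* s N k) ⟩
  s ^ N * geometric s k + s ^ N * s ^ k
    ≡⟨ *-distribˡ-+ (s ^ N) (geometric s k) (s ^ k) ⟨
  s ^ N * geometric s (suc k)
    ∎
  where
  open ≤-Reasoning
  swap : ∀ a t b → a ⊕ t ⊕ ⊖ b ≡ (a ⊕ ⊖ b) ⊕ t
  swap a t b = solve (a ∷ t ∷ b ∷ []) ℚ[√-3]-ring

binomialRemainder : ℕ → ℚ[√-3] → ℚ[√-3] → ℚ[√-3]
binomialRemainder n y e = (y ⊕ e) ^ᴷ suc n ⊕ ⊖ (y ^ᴷ suc n) ⊕ ⊖ (ι (fromℕ (suc n)) ⊗ (e ⊗ y ^ᴷ n))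

binomialRemainder-zero : ∀ y e → binomialRemainder 0 y e ≡ 𝟘
binomialRemainder-zero y e = vanish y e
  where
  vanish : ∀ y e → (y ⊕ e) ⊗ 𝟙 ⊕ ⊖ (y ⊗ 𝟙) ⊕ ⊖ (𝟙 ⊗ (e ⊗ 𝟙)) ≡ 𝟘
  vanish y e = solve (y ∷ e ∷ []) ℚ[√-3]-ring

binomialRemainder-suc : ∀ n y e →
  binomialRemainder (suc n) y e ≡ (y ⊕ e) ⊗ binomialRemainder n y e ⊕ ι (fromℕ (suc n)) ⊗ (e ⊗ e ⊗ y ^ᴷ n)
binomialRemainder-suc n y e = begin
  (y ⊕ e) ⊗ A ⊕ ⊖ (y ⊗ (y ⊗ B)) ⊕ ⊖ (ι (fromℕ (suc (suc n))) ⊗ (e ⊗ (y ⊗ B)))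
    ≡⟨ cong (λ m → (y ⊕ e) ⊗ A ⊕ ⊖ (y ⊗ (y ⊗ B)) ⊕ ⊖ (ι m ⊗ (e ⊗ (y ⊗ B)))) (fromℕ-suc (suc n)) ⟩
  (y ⊕ e) ⊗ A ⊕ ⊖ (y ⊗ (y ⊗ B)) ⊕ ⊖ ((N ⊕ 𝟙) ⊗ (e ⊗ (y ⊗ B)))
    ≡⟨ regroup y e A B N ⟩
  (y ⊕ e) ⊗ (A ⊕ ⊖ (y ⊗ B) ⊕ ⊖ (N ⊗ (e ⊗ B))) ⊕ N ⊗ (e ⊗ e ⊗ B)
    ∎
  where
  open ≡-Reasoning
  A B N : ℚ[√-3]
  A = (y ⊕ e) ^ᴷ suc n
  B = y ^ᴷ n
  N = ι (fromℕ (suc n))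
  regroup : ∀ y e A B N → (y ⊕ e) ⊗ A ⊕ ⊖ (y ⊗ (y ⊗ B)) ⊕ ⊖ ((N ⊕ 𝟙) ⊗ (e ⊗ (y ⊗ B)))
                        ≡ (y ⊕ e) ⊗ (A ⊕ ⊖ (y ⊗ B) ⊕ ⊖ (N ⊗ (e ⊗ B))) ⊕ N ⊗ (e ⊗ e ⊗ B)
  regroup y e A B N = solve (y ∷ e ∷ A ∷ B ∷ N ∷ []) ℚ[√-3]-ring

binomialBound : ℕ → ℚ → ℚ → ℚ
binomialBound m ē s = fromℕ (2 ℕ.+ m) * fromℕ (1 ℕ.+ m) * (ē * ē) * s ^ m

binomialBound-suc : ∀ m ē s → s * binomialBound m ē s + fromℕ (2 ℕ.+ m) * (ē * ē * s ^ suc m)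
                              + fromℕ (2 ℕ.+ m) * (ē * ē * s ^ suc m) ≡ binomialBound (suc m) ē s
binomialBound-suc m ē s = begin
  s * (fromℕ (2 ℕ.+ m) * fromℕ (1 ℕ.+ m) * E * P) + fromℕ (2 ℕ.+ m) * (E * (s * P)) + fromℕ (2 ℕ.+ m) * (E * (s * P))
    ≡⟨ cong₂ (λ a b → s * (b * a * E * P) + b * (E * (s * P)) + b * (E * (s * P))) (fromℕ-suc m) [2+m] ⟩
  s * ((a + 1ℚ + 1ℚ) * (a + 1ℚ) * E * P) + (a + 1ℚ + 1ℚ) * (E * (s * P)) + (a + 1ℚ + 1ℚ) * (E * (s * P))
    ≡⟨ collect a E s P ⟩
  (a + 1ℚ + 1ℚ + 1ℚ) * (a + 1ℚ + 1ℚ) * E * (s * P)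
    ≡⟨ cong₂ (λ a b → b * a * E * (s * P)) (sym [2+m]) (sym (trans (fromℕ-suc (2 ℕ.+ m)) (cong (_+ 1ℚ) [2+m]))) ⟩
  fromℕ (3 ℕ.+ m) * fromℕ (2 ℕ.+ m) * E * (s * P)
    ∎
  where
  open ≡-Reasoning
  a E P : ℚ
  a = fromℕ m
  E = ē * ē
  P = s ^ m
  [2+m] : fromℕ (2 ℕ.+ m) ≡ fromℕ m + 1ℚ + 1ℚ
  [2+m] = trans (fromℕ-suc (suc m)) (cong (_+ 1ℚ) (fromℕ-suc m))
  collect : ∀ a E s P → s * ((a + 1ℚ + 1ℚ) * (a + 1ℚ) * E * P) + (a + 1ℚ + 1ℚ) * (E * (s * P)) + (a + 1ℚ + 1ℚ) * (E * (s * P))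
                      ≡ (a + 1ℚ + 1ℚ + 1ℚ) * (a + 1ℚ + 1ℚ) * E * (s * P)
  collect a E s P = solve (a ∷ E ∷ s ∷ P ∷ []) ℚ-ring

‖binomialRemainder‖-≤ : ∀ m y e {s} → ‖ y ‖ + ‖ e ‖ ≤ s → ‖ binomialRemainder (suc m) y e ‖ ≤ binomialBound m (‖ e ‖) s
‖binomialRemainder‖-≤ zero y e {s} ‖y‖+‖e‖≤s = begin
  ‖ binomialRemainder 1 y e ‖                   ≡⟨ cong ‖_‖ (trans (binomialRemainder-suc 0 y e)
                                                     (cong (λ r → (y ⊕ e) ⊗ r ⊕ ι 1ℚ ⊗ (e ⊗ e ⊗ 𝟙)) (binomialRemainder-zero y e))) ⟩
  ‖ (y ⊕ e) ⊗ 𝟘 ⊕ ι 1ℚ ⊗ (e ⊗ e ⊗ 𝟙) ‖         ≡⟨ cong ‖_‖ (simplify y e) ⟩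
  ‖ e ⊗ e ‖                                     ≤⟨ ‖‖-submultiplicative e e ⟩
  ‖ e ‖ * ‖ e ‖                                 ≤⟨ ≤-+ʳ (*-nonNeg (‖‖-nonNeg e) (‖‖-nonNeg e)) ⟩
  ‖ e ‖ * ‖ e ‖ + ‖ e ‖ * ‖ e ‖                 ≡⟨ double (‖ e ‖) ⟩
  binomialBound 0 (‖ e ‖) s                       ∎
  where
  open ≤-Reasoning
  simplify : ∀ y e → (y ⊕ e) ⊗ 𝟘 ⊕ ι 1ℚ ⊗ (e ⊗ e ⊗ 𝟙) ≡ e ⊗ e
  simplify y e = solve (y ∷ e ∷ []) ℚ[√-3]-ring
  double : ∀ E → E * E + E * E ≡ fromℕ 2 * fromℕ 1 * (E * E) * 1ℚ
  double E = solve (E ∷ []) ℚ-ring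
‖binomialRemainder‖-≤ (suc m) y e {s} ‖y‖+‖e‖≤s = begin
  ‖ binomialRemainder (suc (suc m)) y e ‖
    ≡⟨ cong ‖_‖ (binomialRemainder-suc (suc m) y e) ⟩
  ‖ (y ⊕ e) ⊗ binomialRemainder (suc m) y e ⊕ ι n ⊗ (e ⊗ e ⊗ y ^ᴷ suc m) ‖
    ≤⟨ ‖⊕‖-≤ ((y ⊕ e) ⊗ binomialRemainder (suc m) y e) (ι n ⊗ (e ⊗ e ⊗ y ^ᴷ suc m))
         (‖⊗‖-≤ (y ⊕ e) (binomialRemainder (suc m) y e) (≤-trans (‖‖-triangle y e) ‖y‖+‖e‖≤s)
                (‖binomialRemainder‖-≤ m y e ‖y‖+‖e‖≤s))
         (‖ι⊗‖-≤-scaled (e ⊗ e ⊗ y ^ᴷ suc m) (fromℕ-nonNeg (2 ℕ.+ m))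
           (‖⊗‖-≤ (e ⊗ e) (y ^ᴷ suc m) (‖‖-submultiplicative e e) (‖^ᴷ‖-≤ y (suc m) ‖y‖≤s))) ⟩
  s * binomialBound m (‖ e ‖) s + n * (‖ e ‖ * ‖ e ‖ * s ^ suc m)
    ≤⟨ ≤-+ʳ (*-nonNeg (fromℕ-nonNeg (2 ℕ.+ m)) (*-nonNeg (*-nonNeg (‖‖-nonNeg e) (‖‖-nonNeg e)) (^-nonNeg (suc m) 0≤s))) ⟩
  s * binomialBound m (‖ e ‖) s + n * (‖ e ‖ * ‖ e ‖ * s ^ suc m) + n * (‖ e ‖ * ‖ e ‖ * s ^ suc m)
    ≡⟨ binomialBound-suc m (‖ e ‖) s ⟩
  binomialBound (suc m) (‖ e ‖) s
    ∎
  where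
  open ≤-Reasoning
  n : ℚ
  n = fromℕ (2 ℕ.+ m)
  0≤s : 0ℚ ≤ s
  0≤s = ≤-trans (+-nonNeg (‖‖-nonNeg y) (‖‖-nonNeg e)) ‖y‖+‖e‖≤s
  ‖y‖≤s : ‖ y ‖ ≤ s
  ‖y‖≤s = ≤-trans (≤-+ʳ (‖‖-nonNeg e)) ‖y‖+‖e‖≤s

logTerm-taylor : ∀ n x d → logTerm n (x ⊕ d) ⊕ ⊖ logTerm n x ⊕ ⊖ (d ⊗ (⊖ x) ^ᴷ n)
                         ≡ ⊖ (ι 1/[1+ n ] ⊗ binomialRemainder n (⊖ x) (⊖ d))
logTerm-taylor n x d = begin
  ⊖ (I ⊗ (⊖ (x ⊕ d)) ^ᴷ suc n) ⊕ ⊖ (⊖ (I ⊗ (⊖ x) ^ᴷ suc n)) ⊕ ⊖ (d ⊗ (⊖ x) ^ᴷ n)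
    ≡⟨ cong (λ y → ⊖ (I ⊗ y ^ᴷ suc n) ⊕ ⊖ (⊖ (I ⊗ (⊖ x) ^ᴷ suc n)) ⊕ ⊖ (d ⊗ (⊖ x) ^ᴷ n)) (⊖-distrib-⊕ x d) ⟩
  ⊖ (I ⊗ (⊖ x ⊕ ⊖ d) ^ᴷ suc n) ⊕ ⊖ (⊖ (I ⊗ ((⊖ x) ⊗ (⊖ x) ^ᴷ n))) ⊕ ⊖ (d ⊗ (⊖ x) ^ᴷ n)
    ≡⟨ step I (ι (fromℕ (suc n))) ((⊖ x ⊕ ⊖ d) ^ᴷ suc n) (⊖ x) ((⊖ x) ^ᴷ n) d
            (trans (ι-homo-* 1/[1+ n ] (fromℕ (suc n))) (cong ι (1/[1+n]*[1+n] n))) ⟩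
  ⊖ (I ⊗ binomialRemainder n (⊖ x) (⊖ d))
    ∎
  where
  open ≡-Reasoning
  I : ℚ[√-3]
  I = ι 1/[1+ n ]
  ⊖-distrib-⊕ : ∀ x d → ⊖ (x ⊕ d) ≡ ⊖ x ⊕ ⊖ d
  ⊖-distrib-⊕ x d = solve (x ∷ d ∷ []) ℚ[√-3]-ring
  step : ∀ I N A y P d → I ⊗ N ≡ 𝟙 →
         ⊖ (I ⊗ A) ⊕ ⊖ (⊖ (I ⊗ (y ⊗ P))) ⊕ ⊖ (d ⊗ P) ≡ ⊖ (I ⊗ (A ⊕ ⊖ (y ⊗ P) ⊕ ⊖ (N ⊗ (⊖ d ⊗ P))))
  step I N A y P d I⊗N≡1 = begin
    ⊖ (I ⊗ A) ⊕ ⊖ (⊖ (I ⊗ (y ⊗ P))) ⊕ ⊖ (d ⊗ P)    ≡⟨ solve (I ∷ A ∷ y ∷ P ∷ d ∷ []) ℚ[√-3]-ring ⟩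
    ⊖ (I ⊗ A) ⊕ I ⊗ (y ⊗ P) ⊕ ⊖ (𝟙 ⊗ (d ⊗ P))     ≡⟨ cong (λ o → ⊖ (I ⊗ A) ⊕ I ⊗ (y ⊗ P) ⊕ ⊖ (o ⊗ (d ⊗ P))) I⊗N≡1 ⟨
    ⊖ (I ⊗ A) ⊕ I ⊗ (y ⊗ P) ⊕ ⊖ (I ⊗ N ⊗ (d ⊗ P)) ≡⟨ solve (I ∷ N ∷ A ∷ y ∷ P ∷ d ∷ []) ℚ[√-3]-ring ⟩
    ⊖ (I ⊗ (A ⊕ ⊖ (y ⊗ P) ⊕ ⊖ (N ⊗ (⊖ d ⊗ P))))   ∎

‖logTerm-taylor‖-≤ : ∀ m x d {s} → ‖ x ‖ + ‖ d ‖ ≤ s →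
  ‖ logTerm (suc m) (x ⊕ d) ⊕ ⊖ logTerm (suc m) x ⊕ ⊖ (d ⊗ (⊖ x) ^ᴷ suc m) ‖ ≤ fromℕ (suc m) * (‖ d ‖ * ‖ d ‖) * s ^ m
‖logTerm-taylor‖-≤ m x d {s} ‖x‖+‖d‖≤s = begin
  ‖ logTerm (suc m) (x ⊕ d) ⊕ ⊖ logTerm (suc m) x ⊕ ⊖ (d ⊗ (⊖ x) ^ᴷ suc m) ‖
    ≡⟨ cong ‖_‖ (logTerm-taylor (suc m) x d) ⟩
  ‖ ⊖ (ι 1/[1+ suc m ] ⊗ R) ‖
    ≡⟨ trans (‖‖-⊖ (ι 1/[1+ suc m ] ⊗ R)) (‖ι⊗‖ 1/[1+ suc m ] R (1/[1+]-nonNeg (suc m))) ⟩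
  1/[1+ suc m ] * ‖ R ‖
    ≤⟨ *-monoˡ-≤-nonNeg 1/[1+ suc m ] {{ℚ.nonNegative (1/[1+]-nonNeg (suc m))}}
         (‖binomialRemainder‖-≤ m (⊖ x) (⊖ d) ‖⊖x‖+‖⊖d‖≤s) ⟩
  1/[1+ suc m ] * binomialBound m (‖ ⊖ d ‖) s
    ≡⟨ cong (λ t → 1/[1+ suc m ] * binomialBound m t s) (‖‖-⊖ d) ⟩
  1/[1+ suc m ] * (fromℕ (suc (suc m)) * fromℕ (suc m) * (‖ d ‖ * ‖ d ‖) * s ^ m)
    ≡⟨ reassociate 1/[1+ suc m ] (fromℕ (suc (suc m))) (fromℕ (suc m)) (‖ d ‖ * ‖ d ‖) (s ^ m) ⟩
  (1/[1+ suc m ] * fromℕ (suc (suc m))) * (fromℕ (suc m) * (‖ d ‖ * ‖ d ‖) * s ^ m)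
    ≡⟨ trans (cong (_* (fromℕ (suc m) * (‖ d ‖ * ‖ d ‖) * s ^ m)) (1/[1+n]*[1+n] (suc m))) (*-identityˡ _) ⟩
  fromℕ (suc m) * (‖ d ‖ * ‖ d ‖) * s ^ m
    ∎
  where
  open ≤-Reasoning
  R : ℚ[√-3]
  R = binomialRemainder (suc m) (⊖ x) (⊖ d)
  ‖⊖x‖+‖⊖d‖≤s : ‖ ⊖ x ‖ + ‖ ⊖ d ‖ ≤ s
  ‖⊖x‖+‖⊖d‖≤s = subst₂ (λ a b → a + b ≤ s) (sym (‖‖-⊖ x)) (sym (‖‖-⊖ d)) ‖x‖+‖d‖≤s
  reassociate : ∀ i c a E P → i * (c * a * E * P) ≡ (i * c) * (a * E * P)
  reassociate i c a E P = solve (i ∷ c ∷ a ∷ E ∷ P ∷ []) ℚ-ring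

log₁₊-remainder : ℕ → ℚ[√-3] → ℚ[√-3] → ℚ[√-3]
log₁₊-remainder N x d = log₁₊ N (x ⊕ d) ⊕ ⊖ log₁₊ N x ⊕ ⊖ (d ⊗ log₁₊′ N x)

log₁₊-remainder-suc : ∀ N x d → log₁₊-remainder (suc N) x d
  ≡ log₁₊-remainder N x d ⊕ (logTerm N (x ⊕ d) ⊕ ⊖ logTerm N x ⊕ ⊖ (d ⊗ (⊖ x) ^ᴷ N))
log₁₊-remainder-suc N x d = regroup (log₁₊ N (x ⊕ d)) (logTerm N (x ⊕ d)) (log₁₊ N x) (logTerm N x) d (log₁₊′ N x) ((⊖ x) ^ᴷ N)
  where
  regroup : ∀ L′ T′ L T d D P → (L′ ⊕ T′) ⊕ ⊖ (L ⊕ T) ⊕ ⊖ (d ⊗ (D ⊕ P))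
                              ≡ (L′ ⊕ ⊖ L ⊕ ⊖ (d ⊗ D)) ⊕ (T′ ⊕ ⊖ T ⊕ ⊖ (d ⊗ P))
  regroup L′ T′ L T d D P = solve (L′ ∷ T′ ∷ L ∷ T ∷ d ∷ D ∷ P ∷ []) ℚ[√-3]-ring

‖log₁₊-remainder‖-≤ : ∀ N x d {s} → ‖ x ‖ + ‖ d ‖ ≤ s →
  ‖ log₁₊-remainder (suc N) x d ‖ ≤ (‖ d ‖ * ‖ d ‖) * geometric′ s N
‖log₁₊-remainder‖-≤ zero x d ‖x‖+‖d‖≤s = ≤-reflexive (begin
  ‖ log₁₊-remainder 1 x d ‖
    ≡⟨ cong ‖_‖ (trans (log₁₊-remainder-suc 0 x d) (cong (λ r → 𝟘 ⊕ 𝟘 ⊕ ⊖ (d ⊗ 𝟘) ⊕ r)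
         (trans (logTerm-taylor 0 x d) (cong (λ r → ⊖ (ι 1ℚ ⊗ r)) (binomialRemainder-zero (⊖ x) (⊖ d)))))) ⟩
  ‖ 𝟘 ⊕ 𝟘 ⊕ ⊖ (d ⊗ 𝟘) ⊕ ⊖ (ι 1ℚ ⊗ 𝟘) ‖
    ≡⟨ cong ‖_‖ (vanish d) ⟩
  0ℚ
    ≡⟨ *-zeroʳ (‖ d ‖ * ‖ d ‖) ⟨
  (‖ d ‖ * ‖ d ‖) * 0ℚ
    ∎)
  where
  open ≡-Reasoning
  vanish : ∀ d → 𝟘 ⊕ 𝟘 ⊕ ⊖ (d ⊗ 𝟘) ⊕ ⊖ (ι 1ℚ ⊗ 𝟘) ≡ 𝟘
  vanish d = solve (d ∷ []) ℚ[√-3]-ring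
‖log₁₊-remainder‖-≤ (suc N) x d {s} ‖x‖+‖d‖≤s = begin
  ‖ log₁₊-remainder (suc (suc N)) x d ‖
    ≡⟨ cong ‖_‖ (log₁₊-remainder-suc (suc N) x d) ⟩
  ‖ log₁₊-remainder (suc N) x d ⊕ (logTerm (suc N) (x ⊕ d) ⊕ ⊖ logTerm (suc N) x ⊕ ⊖ (d ⊗ (⊖ x) ^ᴷ suc N)) ‖
    ≤⟨ ‖⊕‖-≤ (log₁₊-remainder (suc N) x d) (logTerm (suc N) (x ⊕ d) ⊕ ⊖ logTerm (suc N) x ⊕ ⊖ (d ⊗ (⊖ x) ^ᴷ suc N))
         (‖log₁₊-remainder‖-≤ N x d ‖x‖+‖d‖≤s) (‖logTerm-taylor‖-≤ N x d ‖x‖+‖d‖≤s) ⟩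
  (‖ d ‖ * ‖ d ‖) * geometric′ s N + fromℕ (suc N) * (‖ d ‖ * ‖ d ‖) * s ^ N
    ≡⟨ factor (‖ d ‖ * ‖ d ‖) (geometric′ s N) (fromℕ (suc N)) (s ^ N) ⟩
  (‖ d ‖ * ‖ d ‖) * geometric′ s (suc N)
    ∎
  where
  open ≤-Reasoning
  factor : ∀ E G a P → E * G + a * E * P ≡ E * (G + a * P)
  factor E G a P = solve (E ∷ G ∷ a ∷ P ∷ []) ℚ-ring

‖ι⊗ι⊗‖ : ∀ s t x → 0ℚ ≤ s → 0ℚ ≤ t → ‖ ι s ⊗ ι t ⊗ x ‖ ≡ (s * t) * ‖ x ‖
‖ι⊗ι⊗‖ s t x 0≤s 0≤t = trans (cong (λ y → ‖ y ⊗ x ‖) (ι-homo-* s t)) (‖ι⊗‖ (s * t) x (*-nonNeg 0≤s 0≤t))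

‖ι⊗‖-≤ : ∀ {l} x → 0ℚ ≤ l → l ≤ 1ℚ → ‖ ι l ⊗ x ‖ ≤ ‖ x ‖
‖ι⊗‖-≤ x 0≤l l≤1 = ≤-trans (≤-reflexive (‖ι⊗‖ _ x 0≤l)) (*-≤-of-≤-1 (‖‖-nonNeg x) l≤1)

‖ι⊗‖+‖ι⊗‖-≤ : ∀ {l h c} x → 0ℚ ≤ l → 0ℚ ≤ h → l + h ≤ 1ℚ → ‖ x ‖ ≤ c → ‖ ι l ⊗ x ‖ + ‖ ι h ⊗ x ‖ ≤ c
‖ι⊗‖+‖ι⊗‖-≤ {l} {h} {c} x 0≤l 0≤h l+h≤1 ‖x‖≤c = begin
  ‖ ι l ⊗ x ‖ + ‖ ι h ⊗ x ‖    ≡⟨ cong₂ _+_ (‖ι⊗‖ l x 0≤l) (‖ι⊗‖ h x 0≤h) ⟩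
  l * ‖ x ‖ + h * ‖ x ‖        ≡⟨ *-distribʳ-+ ‖ x ‖ l h ⟨
  (l + h) * ‖ x ‖              ≤⟨ *-≤-of-≤-1 (‖‖-nonNeg x) l+h≤1 ⟩
  ‖ x ‖                        ≤⟨ ‖x‖≤c ⟩
  c                            ∎
  where open ≤-Reasoning

‖log₁₊′‖-≤ : ∀ N x {s} → ‖ x ‖ ≤ s → ‖ log₁₊′ N x ‖ ≤ geometric s N
‖log₁₊′‖-≤ zero    x ‖x‖≤s = ≤-refl
‖log₁₊′‖-≤ (suc N) x ‖x‖≤s =
  ‖⊕‖-≤ (log₁₊′ N x) ((⊖ x) ^ᴷ N) (‖log₁₊′‖-≤ N x ‖x‖≤s) (‖^ᴷ‖-≤ (⊖ x) N (‖⊖‖-≤ x ‖x‖≤s))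

¾ : ℚ
¾ = + 3 / 4

0≤¾ : 0ℚ ≤ ¾
0≤¾ = ≤-decide 0ℚ ¾

¾≤1 : ¾ ≤ 1ℚ
¾≤1 = ≤-decide ¾ 1ℚ

geometric-¾-≤ : ∀ N → geometric ¾ N ≤ fromℕ 4
geometric-¾-≤ N = geometric-≤ N 0≤¾ ¾≤1 (fromℕ-nonNeg 4) (≤-decide 1ℚ (fromℕ 4 * (1ℚ - ¾)))

‖log₁₊-remainder‖-≤-¾ : ∀ N x d {δ} → ‖ x ‖ + ‖ d ‖ ≤ ¾ → ‖ d ‖ ≤ δ →
                        ‖ log₁₊-remainder (suc N) x d ‖ ≤ (δ * δ) * fromℕ 16
‖log₁₊-remainder‖-≤-¾ N x d ‖x‖+‖d‖≤¾ ‖d‖≤δ = ≤-trans (‖log₁₊-remainder‖-≤ N x d ‖x‖+‖d‖≤¾)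
  (*-mono-≤-nonNeg (*-nonNeg (‖‖-nonNeg d) (‖‖-nonNeg d)) (geometric′-nonNeg N 0≤¾)
    (*-mono-≤-nonNeg (‖‖-nonNeg d) (‖‖-nonNeg d) ‖d‖≤δ ‖d‖≤δ)
    (geometric′-≤ N 0≤¾ ¾≤1 (fromℕ-nonNeg 16) (≤-decide 1ℚ (fromℕ 16 * ((1ℚ - ¾) * (1ℚ - ¾))))))

module LogOfProduct (u v : ℚ[√-3]) where

  -- The path λ ↦ w λ is chosen so that 1 + w λ = (1 + λu)(1 + λv).
  w : ℚ → ℚ[√-3]
  w l = ι l ⊗ (u ⊕ v) ⊕ ι l ⊗ ι l ⊗ (u ⊗ v)

  w′ : ℚ → ℚ[√-3]
  w′ l = u ⊕ v ⊕ (ι l ⊕ ι l) ⊗ (u ⊗ v)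

  Φ : ℕ → ℚ → ℚ[√-3]
  Φ N l = log₁₊ N (ι l ⊗ u) ⊕ log₁₊ N (ι l ⊗ v) ⊕ ⊖ log₁₊ N (w l)

  Φ′ : ℕ → ℚ → ℚ[√-3]
  Φ′ N l = u ⊗ log₁₊′ N (ι l ⊗ u) ⊕ v ⊗ log₁₊′ N (ι l ⊗ v) ⊕ ⊖ (w′ l ⊗ log₁₊′ N (w l))

  Φ′-defect : ℕ → ℚ → ℚ[√-3]
  Φ′-defect N l = ⊖ (u ⊗ (𝟙 ⊕ ι l ⊗ v) ⊗ (⊖ (ι l ⊗ u)) ^ᴷ N)
                ⊕ ⊖ (v ⊗ (𝟙 ⊕ ι l ⊗ u) ⊗ (⊖ (ι l ⊗ v)) ^ᴷ N)
                ⊕ w′ l ⊗ (⊖ w l) ^ᴷ N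

  [1+w]⊗Φ′ : ∀ N l → (𝟙 ⊕ w l) ⊗ Φ′ N l ≡ Φ′-defect N l
  [1+w]⊗Φ′ N l = begin
    (𝟙 ⊕ w l) ⊗ Φ′ N l
      ≡⟨ factor (ι l) u v (log₁₊′ N a) (log₁₊′ N b) (log₁₊′ N (w l)) ⟩
    (u ⊗ (𝟙 ⊕ b)) ⊗ ((𝟙 ⊕ a) ⊗ log₁₊′ N a) ⊕ (v ⊗ (𝟙 ⊕ a)) ⊗ ((𝟙 ⊕ b) ⊗ log₁₊′ N b)
      ⊕ ⊖ (w′ l ⊗ ((𝟙 ⊕ w l) ⊗ log₁₊′ N (w l)))
      ≡⟨ cong₃ (λ A B W → (u ⊗ (𝟙 ⊕ b)) ⊗ A ⊕ (v ⊗ (𝟙 ⊕ a)) ⊗ B ⊕ ⊖ (w′ l ⊗ W))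
               (log₁₊′-closed N a) (log₁₊′-closed N b) (log₁₊′-closed N (w l)) ⟩
    (u ⊗ (𝟙 ⊕ b)) ⊗ (𝟙 ⊕ ⊖ ((⊖ a) ^ᴷ N)) ⊕ (v ⊗ (𝟙 ⊕ a)) ⊗ (𝟙 ⊕ ⊖ ((⊖ b) ^ᴷ N))
      ⊕ ⊖ (w′ l ⊗ (𝟙 ⊕ ⊖ ((⊖ w l) ^ᴷ N)))
      ≡⟨ expand (ι l) u v ((⊖ a) ^ᴷ N) ((⊖ b) ^ᴷ N) ((⊖ w l) ^ᴷ N) ⟩
    Φ′-defect N l
      ∎
    where
    open ≡-Reasoning
    a b : ℚ[√-3]
    a = ι l ⊗ u
    b = ι l ⊗ v
    factor : ∀ λ̂ u v A B W →
      (𝟙 ⊕ (λ̂ ⊗ (u ⊕ v) ⊕ λ̂ ⊗ λ̂ ⊗ (u ⊗ v))) ⊗ (u ⊗ A ⊕ v ⊗ B ⊕ ⊖ ((u ⊕ v ⊕ (λ̂ ⊕ λ̂) ⊗ (u ⊗ v)) ⊗ W))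
      ≡ (u ⊗ (𝟙 ⊕ λ̂ ⊗ v)) ⊗ ((𝟙 ⊕ λ̂ ⊗ u) ⊗ A) ⊕ (v ⊗ (𝟙 ⊕ λ̂ ⊗ u)) ⊗ ((𝟙 ⊕ λ̂ ⊗ v) ⊗ B)
        ⊕ ⊖ ((u ⊕ v ⊕ (λ̂ ⊕ λ̂) ⊗ (u ⊗ v)) ⊗ ((𝟙 ⊕ (λ̂ ⊗ (u ⊕ v) ⊕ λ̂ ⊗ λ̂ ⊗ (u ⊗ v))) ⊗ W))
    factor λ̂ u v A B W = solve (λ̂ ∷ u ∷ v ∷ A ∷ B ∷ W ∷ []) ℚ[√-3]-ring
    expand : ∀ λ̂ u v A B W →
      (u ⊗ (𝟙 ⊕ λ̂ ⊗ v)) ⊗ (𝟙 ⊕ ⊖ A) ⊕ (v ⊗ (𝟙 ⊕ λ̂ ⊗ u)) ⊗ (𝟙 ⊕ ⊖ B) ⊕ ⊖ ((u ⊕ v ⊕ (λ̂ ⊕ λ̂) ⊗ (u ⊗ v)) ⊗ (𝟙 ⊕ ⊖ W))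
      ≡ ⊖ (u ⊗ (𝟙 ⊕ λ̂ ⊗ v) ⊗ A) ⊕ ⊖ (v ⊗ (𝟙 ⊕ λ̂ ⊗ u) ⊗ B) ⊕ (u ⊕ v ⊕ (λ̂ ⊕ λ̂) ⊗ (u ⊗ v)) ⊗ W
    expand λ̂ u v A B W = solve (λ̂ ∷ u ∷ v ∷ A ∷ B ∷ W ∷ []) ℚ[√-3]-ring

  Φ′-fixedPoint : ∀ N l → Φ′ N l ≡ Φ′-defect N l ⊕ ⊖ (w l ⊗ Φ′ N l)
  Φ′-fixedPoint N l = trans (split (w l) (Φ′ N l)) (cong (_⊕ ⊖ (w l ⊗ Φ′ N l)) ([1+w]⊗Φ′ N l))
    where
    split : ∀ w g → g ≡ (𝟙 ⊕ w) ⊗ g ⊕ ⊖ (w ⊗ g)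
    split w g = solve (w ∷ g ∷ []) ℚ[√-3]-ring

  Δw : ℚ → ℚ → ℚ[√-3]
  Δw l h = ι h ⊗ (u ⊕ v) ⊕ (ι l ⊕ ι l ⊕ ι h) ⊗ ι h ⊗ (u ⊗ v)

  Φ-remainder : ℕ → ℚ → ℚ → ℚ[√-3]
  Φ-remainder N l h = log₁₊-remainder N (ι l ⊗ u) (ι h ⊗ u) ⊕ log₁₊-remainder N (ι l ⊗ v) (ι h ⊗ v)
                    ⊕ ⊖ log₁₊-remainder N (w l) (Δw l h) ⊕ ⊖ (ι h ⊗ ι h ⊗ (u ⊗ v) ⊗ log₁₊′ N (w l))

  Φ-step : ∀ N l h → Φ N (l + h) ≡ Φ N l ⊕ ι h ⊗ Φ′ N l ⊕ Φ-remainder N l h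
  Φ-step N l h = begin
    Φ N (l + h)
      ≡⟨ cong₃ (λ a b c → log₁₊ N a ⊕ log₁₊ N b ⊕ ⊖ log₁₊ N c) (shift u) (shift v) w-shift ⟩
    log₁₊ N (a ⊕ ι h ⊗ u) ⊕ log₁₊ N (b ⊕ ι h ⊗ v) ⊕ ⊖ log₁₊ N (w l ⊕ Δw l h)
      ≡⟨ expand (log₁₊ N (a ⊕ ι h ⊗ u)) (log₁₊ N (b ⊕ ι h ⊗ v)) (log₁₊ N (w l ⊕ Δw l h))
                (log₁₊ N a) (log₁₊ N b) (log₁₊ N (w l)) (log₁₊′ N a) (log₁₊′ N b) (log₁₊′ N (w l)) (ι l) (ι h) u v ⟩
    Φ N l ⊕ ι h ⊗ Φ′ N l ⊕ Φ-remainder N l h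
      ∎
    where
    open ≡-Reasoning
    a b : ℚ[√-3]
    a = ι l ⊗ u
    b = ι l ⊗ v
    shift : ∀ x → ι (l + h) ⊗ x ≡ ι l ⊗ x ⊕ ι h ⊗ x
    shift x = trans (cong (_⊗ x) (sym (ι-homo-+ l h))) (distrib (ι l) (ι h) x)
      where
      distrib : ∀ l h x → (l ⊕ h) ⊗ x ≡ l ⊗ x ⊕ h ⊗ x
      distrib l h x = solve (l ∷ h ∷ x ∷ []) ℚ[√-3]-ring
    w-shift : w (l + h) ≡ w l ⊕ Δw l h
    w-shift = trans (cong (λ λ̂ → λ̂ ⊗ (u ⊕ v) ⊕ λ̂ ⊗ λ̂ ⊗ (u ⊗ v)) (sym (ι-homo-+ l h))) (expand² (ι l) (ι h) u v)
      where
      expand² : ∀ l h u v → (l ⊕ h) ⊗ (u ⊕ v) ⊕ (l ⊕ h) ⊗ (l ⊕ h) ⊗ (u ⊗ v)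
                          ≡ l ⊗ (u ⊕ v) ⊕ l ⊗ l ⊗ (u ⊗ v) ⊕ (h ⊗ (u ⊕ v) ⊕ (l ⊕ l ⊕ h) ⊗ h ⊗ (u ⊗ v))
      expand² l h u v = solve (l ∷ h ∷ u ∷ v ∷ []) ℚ[√-3]-ring
    expand : ∀ La′ Lb′ Lw′ La Lb Lw Da Db Dw λ̂ ĥ u v →
      La′ ⊕ Lb′ ⊕ ⊖ Lw′
      ≡ (La ⊕ Lb ⊕ ⊖ Lw) ⊕ ĥ ⊗ (u ⊗ Da ⊕ v ⊗ Db ⊕ ⊖ ((u ⊕ v ⊕ (λ̂ ⊕ λ̂) ⊗ (u ⊗ v)) ⊗ Dw))
        ⊕ ((La′ ⊕ ⊖ La ⊕ ⊖ (ĥ ⊗ u ⊗ Da)) ⊕ (Lb′ ⊕ ⊖ Lb ⊕ ⊖ (ĥ ⊗ v ⊗ Db))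
           ⊕ ⊖ (Lw′ ⊕ ⊖ Lw ⊕ ⊖ ((ĥ ⊗ (u ⊕ v) ⊕ (λ̂ ⊕ λ̂ ⊕ ĥ) ⊗ ĥ ⊗ (u ⊗ v)) ⊗ Dw))
           ⊕ ⊖ (ĥ ⊗ ĥ ⊗ (u ⊗ v) ⊗ Dw))
    expand La′ Lb′ Lw′ La Lb Lw Da Db Dw λ̂ ĥ u v =
      solve (La′ ∷ Lb′ ∷ Lw′ ∷ La ∷ Lb ∷ Lw ∷ Da ∷ Db ∷ Dw ∷ λ̂ ∷ ĥ ∷ u ∷ v ∷ []) ℚ[√-3]-ring

  module _ (‖u‖≤¾ : ‖ u ‖ ≤ ¾) (‖v‖≤¾ : ‖ v ‖ ≤ ¾) (S+P≤¾ : ‖ u ⊕ v ‖ + ‖ u ⊗ v ‖ ≤ ¾) where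

    private
      S P : ℚ
      S = ‖ u ⊕ v ‖
      P = ‖ u ⊗ v ‖

      P≤¾ : P ≤ ¾
      P≤¾ = ≤-trans (subst (_≤ S + P) (+-identityˡ P) (+-monoˡ-≤ P (‖‖-nonNeg (u ⊕ v)))) S+P≤¾

      S+P+P≤¾+¾ : S + (P + P) ≤ ¾ + ¾
      S+P+P≤¾+¾ = ≤-trans (≤-reflexive (sym (+-assoc S P P))) (+-mono-≤ S+P≤¾ P≤¾)

    ‖w‖-≤ : ∀ l → 0ℚ ≤ l → ‖ w l ‖ ≤ l * S + (l * l) * P
    ‖w‖-≤ l 0≤l = ‖⊕‖-≤ (ι l ⊗ (u ⊕ v)) (ι l ⊗ ι l ⊗ (u ⊗ v))
      (≤-reflexive (‖ι⊗‖ l (u ⊕ v) 0≤l)) (≤-reflexive (‖ι⊗ι⊗‖ l l (u ⊗ v) 0≤l 0≤l))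

    ‖w‖-≤-¾ : ∀ l → 0ℚ ≤ l → l ≤ 1ℚ → ‖ w l ‖ ≤ ¾
    ‖w‖-≤-¾ l 0≤l l≤1 = ≤-trans (‖w‖-≤ l 0≤l)
      (≤-trans (+-mono-≤ (*-≤-of-≤-1 (‖‖-nonNeg (u ⊕ v)) l≤1)
                         (*-≤-of-≤-1 (‖‖-nonNeg (u ⊗ v)) (≤-trans (*-≤-of-≤-1 0≤l l≤1) l≤1)))
               S+P≤¾)

    ‖w′‖-≤ : ∀ l → 0ℚ ≤ l → l ≤ 1ℚ → ‖ w′ l ‖ ≤ ¾ + ¾
    ‖w′‖-≤ l 0≤l l≤1 = begin
      ‖ w′ l ‖                           ≤⟨ ‖‖-triangle (u ⊕ v) (ι (l + l) ⊗ (u ⊗ v)) ⟩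
      S + ‖ ι (l + l) ⊗ (u ⊗ v) ‖       ≡⟨ cong (λ t → S + t) (‖ι⊗‖ (l + l) (u ⊗ v) (+-nonNeg 0≤l 0≤l)) ⟩
      S + (l + l) * P                   ≡⟨ cong (λ t → S + t) (*-distribʳ-+ P l l) ⟩
      S + (l * P + l * P)               ≤⟨ +-monoʳ-≤ S (+-mono-≤ (*-≤-of-≤-1 (‖‖-nonNeg (u ⊗ v)) l≤1)
                                                                 (*-≤-of-≤-1 (‖‖-nonNeg (u ⊗ v)) l≤1)) ⟩
      S + (P + P)                       ≤⟨ S+P+P≤¾+¾ ⟩
      ¾ + ¾                             ∎
      where open ≤-Reasoning

    ‖Φ′-defect‖-≤ : ∀ N l → 0ℚ ≤ l → l ≤ 1ℚ → ‖ Φ′-defect N l ‖ ≤ fromℕ 5 * ¾ ^ N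
    ‖Φ′-defect‖-≤ N l 0≤l l≤1 = begin
      ‖ Φ′-defect N l ‖
        ≤⟨ ‖⊕‖-≤ (⊖ (u ⊗ (𝟙 ⊕ b) ⊗ (⊖ a) ^ᴷ N) ⊕ ⊖ (v ⊗ (𝟙 ⊕ a) ⊗ (⊖ b) ^ᴷ N)) (w′ l ⊗ (⊖ w l) ^ᴷ N)
             (‖⊕‖-≤ (⊖ (u ⊗ (𝟙 ⊕ b) ⊗ (⊖ a) ^ᴷ N)) (⊖ (v ⊗ (𝟙 ⊕ a) ⊗ (⊖ b) ^ᴷ N))
               (‖⊖‖-≤ (u ⊗ (𝟙 ⊕ b) ⊗ (⊖ a) ^ᴷ N) (cross u b ‖u‖≤¾ (‖ι⊗‖-≤-¾ v ‖v‖≤¾) (‖ι⊗‖-≤-¾ u ‖u‖≤¾)))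
               (‖⊖‖-≤ (v ⊗ (𝟙 ⊕ a) ⊗ (⊖ b) ^ᴷ N) (cross v a ‖v‖≤¾ (‖ι⊗‖-≤-¾ u ‖u‖≤¾) (‖ι⊗‖-≤-¾ v ‖v‖≤¾))))
             (‖⊗‖-≤ (w′ l) ((⊖ w l) ^ᴷ N) (‖w′‖-≤ l 0≤l l≤1) (‖^ᴷ‖-≤ (⊖ w l) N (‖⊖‖-≤ (w l) (‖w‖-≤-¾ l 0≤l l≤1)))) ⟩
      ¾ * (1ℚ + ¾) * ¾ ^ N + ¾ * (1ℚ + ¾) * ¾ ^ N + (¾ + ¾) * ¾ ^ N
        ≡⟨ collect (¾ ^ N) ⟩
      (¾ * (1ℚ + ¾) + ¾ * (1ℚ + ¾) + (¾ + ¾)) * ¾ ^ N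
        ≤⟨ *-monoʳ-≤-nonNeg (¾ ^ N) {{ℚ.nonNegative (^-nonNeg N 0≤¾)}}
             (≤-decide (¾ * (1ℚ + ¾) + ¾ * (1ℚ + ¾) + (¾ + ¾)) (fromℕ 5)) ⟩
      fromℕ 5 * ¾ ^ N
        ∎
      where
      open ≤-Reasoning
      a b : ℚ[√-3]
      a = ι l ⊗ u
      b = ι l ⊗ v
      ‖ι⊗‖-≤-¾ : ∀ x → ‖ x ‖ ≤ ¾ → ‖ ι l ⊗ x ‖ ≤ ¾
      ‖ι⊗‖-≤-¾ x ‖x‖≤¾ = ≤-trans (‖ι⊗‖-≤ x 0≤l l≤1) ‖x‖≤¾
      cross : ∀ x y → ‖ x ‖ ≤ ¾ → ‖ y ‖ ≤ ¾ → ‖ ι l ⊗ x ‖ ≤ ¾ → ‖ x ⊗ (𝟙 ⊕ y) ⊗ (⊖ (ι l ⊗ x)) ^ᴷ N ‖ ≤ ¾ * (1ℚ + ¾) * ¾ ^ N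
      cross x y ‖x‖≤¾ ‖y‖≤¾ ‖λx‖≤¾ = ‖⊗‖-≤ (x ⊗ (𝟙 ⊕ y)) ((⊖ (ι l ⊗ x)) ^ᴷ N)
        (‖⊗‖-≤ x (𝟙 ⊕ y) ‖x‖≤¾ (‖⊕‖-≤ 𝟙 y ≤-refl ‖y‖≤¾))
        (‖^ᴷ‖-≤ (⊖ (ι l ⊗ x)) N (‖⊖‖-≤ (ι l ⊗ x) ‖λx‖≤¾))
      collect : ∀ Q → ¾ * (1ℚ + ¾) * Q + ¾ * (1ℚ + ¾) * Q + (¾ + ¾) * Q ≡ (¾ * (1ℚ + ¾) + ¾ * (1ℚ + ¾) + (¾ + ¾)) * Q
      collect Q = solve (Q ∷ []) ℚ-ring

    ‖Φ′‖-≤ : ∀ N l → 0ℚ ≤ l → l ≤ 1ℚ → ‖ Φ′ N l ‖ ≤ fromℕ 20 * ¾ ^ N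
    ‖Φ′‖-≤ N l 0≤l l≤1 = ≤-trans
      (absorb {Y = fromℕ 5 * ¾ ^ N} {r = ¾} (‖‖-nonNeg (Φ′ N l)) (fromℕ-nonNeg 4) ‖Φ′‖≤defect+¾‖Φ′‖ (≤-decide 1ℚ (fromℕ 4 * (1ℚ - ¾))))
      (≤-reflexive (sym (*-assoc (fromℕ 4) (fromℕ 5) (¾ ^ N))))
      where
      open ≤-Reasoning
      ‖Φ′‖≤defect+¾‖Φ′‖ : ‖ Φ′ N l ‖ ≤ fromℕ 5 * ¾ ^ N + ¾ * ‖ Φ′ N l ‖
      ‖Φ′‖≤defect+¾‖Φ′‖ = begin
        ‖ Φ′ N l ‖                                ≡⟨ cong ‖_‖ (Φ′-fixedPoint N l) ⟩
        ‖ Φ′-defect N l ⊕ ⊖ (w l ⊗ Φ′ N l) ‖      ≤⟨ ‖⊕‖-≤ (Φ′-defect N l) (⊖ (w l ⊗ Φ′ N l)) (‖Φ′-defect‖-≤ N l 0≤l l≤1)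
                                                       (‖⊖‖-≤ (w l ⊗ Φ′ N l) (‖⊗‖-≤ (w l) (Φ′ N l) (‖w‖-≤-¾ l 0≤l l≤1) ≤-refl)) ⟩
        fromℕ 5 * ¾ ^ N + ¾ * ‖ Φ′ N l ‖          ∎

    ‖Δw‖-≤ : ∀ l h → 0ℚ ≤ l → 0ℚ ≤ h → ‖ Δw l h ‖ ≤ h * S + ((l + l + h) * h) * P
    ‖Δw‖-≤ l h 0≤l 0≤h = ‖⊕‖-≤ (ι h ⊗ (u ⊕ v)) (ι (l + l + h) ⊗ ι h ⊗ (u ⊗ v))
      (≤-reflexive (‖ι⊗‖ h (u ⊕ v) 0≤h))
      (≤-reflexive (‖ι⊗ι⊗‖ (l + l + h) h (u ⊗ v) (+-nonNeg (+-nonNeg 0≤l 0≤l) 0≤h) 0≤h))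

    ‖w‖+‖Δw‖-≤-¾ : ∀ l h → 0ℚ ≤ l → 0ℚ ≤ h → l + h ≤ 1ℚ → ‖ w l ‖ + ‖ Δw l h ‖ ≤ ¾
    ‖w‖+‖Δw‖-≤-¾ l h 0≤l 0≤h l+h≤1 = begin
      ‖ w l ‖ + ‖ Δw l h ‖                                     ≤⟨ +-mono-≤ (‖w‖-≤ l 0≤l) (‖Δw‖-≤ l h 0≤l 0≤h) ⟩
      (l * S + (l * l) * P) + (h * S + ((l + l + h) * h) * P)  ≡⟨ complete-square l h S P ⟩
      (l + h) * S + ((l + h) * (l + h)) * P                    ≤⟨ +-mono-≤ (*-≤-of-≤-1 (‖‖-nonNeg (u ⊕ v)) l+h≤1)
                                                                    (*-≤-of-≤-1 (‖‖-nonNeg (u ⊗ v))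
                                                                      (≤-trans (*-≤-of-≤-1 (+-nonNeg 0≤l 0≤h) l+h≤1) l+h≤1)) ⟩
      S + P                                                    ≤⟨ S+P≤¾ ⟩
      ¾                                                        ∎
      where
      open ≤-Reasoning
      complete-square : ∀ l h S P → (l * S + (l * l) * P) + (h * S + ((l + l + h) * h) * P)
                                  ≡ (l + h) * S + ((l + h) * (l + h)) * P
      complete-square l h S P = solve (l ∷ h ∷ S ∷ P ∷ []) ℚ-ring

    ‖Δw‖-≤-¾+¾ : ∀ l h → 0ℚ ≤ l → 0ℚ ≤ h → l + h ≤ 1ℚ → ‖ Δw l h ‖ ≤ h * (¾ + ¾)
    ‖Δw‖-≤-¾+¾ l h 0≤l 0≤h l+h≤1 = begin
      ‖ Δw l h ‖                          ≤⟨ ‖Δw‖-≤ l h 0≤l 0≤h ⟩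
      h * S + ((l + l + h) * h) * P       ≤⟨ +-monoʳ-≤ (h * S) (*-monoʳ-≤-nonNeg P {{ℚ.nonNegative (‖‖-nonNeg (u ⊗ v))}}
                                              (*-monoʳ-≤-nonNeg h {{ℚ.nonNegative 0≤h}}
                                                (≤-trans (≤-reflexive (+-assoc l l h)) (+-mono-≤ (≤-trans (≤-+ʳ {l} 0≤h) l+h≤1) l+h≤1)))) ⟩
      h * S + ((1ℚ + 1ℚ) * h) * P         ≡⟨ factor h S P ⟩
      h * (S + (P + P))                   ≤⟨ *-monoˡ-≤-nonNeg h {{ℚ.nonNegative 0≤h}} S+P+P≤¾+¾ ⟩
      h * (¾ + ¾)                         ∎
      where
      open ≤-Reasoning
      factor : ∀ h S P → h * S + ((1ℚ + 1ℚ) * h) * P ≡ h * (S + (P + P))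
      factor h S P = solve (h ∷ S ∷ P ∷ []) ℚ-ring

    ‖Φ-remainder‖-≤ : ∀ N l h → 0ℚ ≤ l → 0ℚ ≤ h → l + h ≤ 1ℚ → ‖ Φ-remainder (suc N) l h ‖ ≤ h * h * fromℕ 111
    ‖Φ-remainder‖-≤ N l h 0≤l 0≤h l+h≤1 = begin
      ‖ Φ-remainder (suc N) l h ‖
        ≤⟨ ‖⊕‖-≤ (Rᵤ ⊕ Rᵥ ⊕ ⊖ R_w) (⊖ (ι h ⊗ ι h ⊗ (u ⊗ v) ⊗ log₁₊′ (suc N) (w l)))
             (‖⊕‖-≤ (Rᵤ ⊕ Rᵥ) (⊖ R_w)
               (‖⊕‖-≤ Rᵤ Rᵥ (Taylor-along u ‖u‖≤¾) (Taylor-along v ‖v‖≤¾))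
               (‖⊖‖-≤ R_w (‖log₁₊-remainder‖-≤-¾ N (w l) (Δw l h) (‖w‖+‖Δw‖-≤-¾ l h 0≤l 0≤h l+h≤1)
                                                                   (‖Δw‖-≤-¾+¾ l h 0≤l 0≤h l+h≤1))))
             (‖⊖‖-≤ (ι h ⊗ ι h ⊗ (u ⊗ v) ⊗ log₁₊′ (suc N) (w l))
               (‖⊗‖-≤ (ι h ⊗ ι h ⊗ (u ⊗ v)) (log₁₊′ (suc N) (w l))
                 (≤-trans (≤-reflexive (‖ι⊗ι⊗‖ h h (u ⊗ v) 0≤h 0≤h)) (*-monoˡ-≤-nonNeg (h * h) {{ℚ.nonNegative (*-nonNeg 0≤h 0≤h)}} P≤¾))
                 (≤-trans (‖log₁₊′‖-≤ (suc N) (w l) (‖w‖-≤-¾ l 0≤l (≤-trans (≤-+ʳ {l} 0≤h) l+h≤1))) (geometric-¾-≤ (suc N))))) ⟩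
      δ * δ * fromℕ 16 + δ * δ * fromℕ 16 + δ * δ * fromℕ 16 + h * h * ¾ * fromℕ 4
        ≡⟨ collect h ⟩
      h * h * ((¾ + ¾) * (¾ + ¾) * fromℕ 48 + ¾ * fromℕ 4)
        ≤⟨ *-monoˡ-≤-nonNeg (h * h) {{ℚ.nonNegative (*-nonNeg 0≤h 0≤h)}}
             (≤-decide ((¾ + ¾) * (¾ + ¾) * fromℕ 48 + ¾ * fromℕ 4) (fromℕ 111)) ⟩
      h * h * fromℕ 111
        ∎
      where
      open ≤-Reasoning
      δ : ℚ
      δ = h * (¾ + ¾)
      Rᵤ Rᵥ R_w : ℚ[√-3]
      Rᵤ = log₁₊-remainder (suc N) (ι l ⊗ u) (ι h ⊗ u)
      Rᵥ = log₁₊-remainder (suc N) (ι l ⊗ v) (ι h ⊗ v)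
      R_w = log₁₊-remainder (suc N) (w l) (Δw l h)
      Taylor-along : ∀ x → ‖ x ‖ ≤ ¾ → ‖ log₁₊-remainder (suc N) (ι l ⊗ x) (ι h ⊗ x) ‖ ≤ δ * δ * fromℕ 16
      Taylor-along x ‖x‖≤¾ = ‖log₁₊-remainder‖-≤-¾ N (ι l ⊗ x) (ι h ⊗ x)
        (‖ι⊗‖+‖ι⊗‖-≤ x 0≤l 0≤h l+h≤1 ‖x‖≤¾) (‖ι⊗‖-≤-scaled x 0≤h (≤-trans ‖x‖≤¾ (≤-+ʳ 0≤¾)))
      collect : ∀ h → (h * (¾ + ¾)) * (h * (¾ + ¾)) * fromℕ 16 + (h * (¾ + ¾)) * (h * (¾ + ¾)) * fromℕ 16
                    + (h * (¾ + ¾)) * (h * (¾ + ¾)) * fromℕ 16 + h * h * ¾ * fromℕ 4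
                    ≡ h * h * ((¾ + ¾) * (¾ + ¾) * fromℕ 48 + ¾ * fromℕ 4)
      collect h = solve (h ∷ []) ℚ-ring

    ‖Φ‖-increment : ∀ N → IncrementBound (λ l → ‖ Φ (suc N) l ‖) (fromℕ 20 * ¾ ^ suc N) 111
    ‖Φ‖-increment N l h 0≤l 0≤h l+h≤1 = begin
      ‖ Φ (suc N) (l + h) ‖
        ≡⟨ cong ‖_‖ (Φ-step (suc N) l h) ⟩
      ‖ Φ (suc N) l ⊕ ι h ⊗ Φ′ (suc N) l ⊕ Φ-remainder (suc N) l h ‖
        ≤⟨ ‖⊕‖-≤ (Φ (suc N) l ⊕ ι h ⊗ Φ′ (suc N) l) (Φ-remainder (suc N) l h)
             (‖⊕‖-≤ (Φ (suc N) l) (ι h ⊗ Φ′ (suc N) l) ≤-refl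
               (≤-trans (≤-reflexive (‖ι⊗‖ h (Φ′ (suc N) l) 0≤h))
                        (*-monoˡ-≤-nonNeg h {{ℚ.nonNegative 0≤h}} (‖Φ′‖-≤ (suc N) l 0≤l (≤-trans (≤-+ʳ 0≤h) l+h≤1)))))
             (‖Φ-remainder‖-≤ N l h 0≤l 0≤h l+h≤1) ⟩
      ‖ Φ (suc N) l ‖ + h * (fromℕ 20 * ¾ ^ suc N) + h * h * fromℕ 111
        ∎
      where open ≤-Reasoning

    Φ-at-0 : ∀ N → Φ N 0ℚ ≡ 𝟘
    Φ-at-0 N = begin
      log₁₊ N (ι 0ℚ ⊗ u) ⊕ log₁₊ N (ι 0ℚ ⊗ v) ⊕ ⊖ log₁₊ N (w 0ℚ)
        ≡⟨ cong₃ (λ a b c → log₁₊ N a ⊕ log₁₊ N b ⊕ ⊖ log₁₊ N c) (annihilate u) (annihilate v) (vanish u v) ⟩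
      log₁₊ N 𝟘 ⊕ log₁₊ N 𝟘 ⊕ ⊖ log₁₊ N 𝟘
        ≡⟨ cong₃ (λ a b c → a ⊕ b ⊕ ⊖ c) (log₁₊-zero N) (log₁₊-zero N) (log₁₊-zero N) ⟩
      𝟘 ⊕ 𝟘 ⊕ ⊖ 𝟘
        ≡⟨⟩
      𝟘 ∎
      where
      open ≡-Reasoning
      annihilate : ∀ x → ι 0ℚ ⊗ x ≡ 𝟘
      annihilate x = solve (x ∷ []) ℚ[√-3]-ring
      vanish : ∀ u v → ι 0ℚ ⊗ (u ⊕ v) ⊕ ι 0ℚ ⊗ ι 0ℚ ⊗ (u ⊗ v) ≡ 𝟘
      vanish u v = solve (u ∷ v ∷ []) ℚ[√-3]-ring

    Φ-at-1 : ∀ N → Φ N 1ℚ ≡ log₁₊ N u ⊕ log₁₊ N v ⊕ ⊖ log₁₊ N (u ⊕ v ⊕ u ⊗ v)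
    Φ-at-1 N = cong₃ (λ a b c → log₁₊ N a ⊕ log₁₊ N b ⊕ ⊖ log₁₊ N c) (unit u) (unit v) (endpoint u v)
      where
      unit : ∀ x → ι 1ℚ ⊗ x ≡ x
      unit x = solve (x ∷ []) ℚ[√-3]-ring
      endpoint : ∀ u v → ι 1ℚ ⊗ (u ⊕ v) ⊕ ι 1ℚ ⊗ ι 1ℚ ⊗ (u ⊗ v) ≡ u ⊕ v ⊕ u ⊗ v
      endpoint u v = solve (u ∷ v ∷ []) ℚ[√-3]-ring

    log₁₊-of-product : ∀ N → ‖ log₁₊ N u ⊕ log₁₊ N v ⊕ ⊖ log₁₊ N (u ⊕ v ⊕ u ⊗ v) ‖ ≤ fromℕ 20 * ¾ ^ N
    log₁₊-of-product zero    = ≤-decide 0ℚ (fromℕ 20)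
    log₁₊-of-product (suc N) = subst (_≤ fromℕ 20 * ¾ ^ suc N) (cong ‖_‖ (Φ-at-1 (suc N)))
      (bounded-increments⇒≤ (λ l → ‖ Φ (suc N) l ‖) (fromℕ 20 * ¾ ^ suc N) 111
        (≤-reflexive (cong ‖_‖ (Φ-at-0 (suc N)))) (‖Φ‖-increment N))

u v z : ℚ[√-3]
u = mk 0ℚ (+ 1 / 3)
v = mk (- (+ 1 / 6)) (- (+ 1 / 6))
z = mk 0ℚ (+ 1 / 9)

u⊕v⊕u⊗v≡z : u ⊕ v ⊕ u ⊗ v ≡ z
u⊕v⊕u⊗v≡z = refl

[-u]¹²≡1/729 : (⊖ u) ^ᴷ 12 ≡ ι (+ 1 / 729)
[-u]¹²≡1/729 = refl

[-z]⁴≡1/729 : (⊖ z) ^ᴷ 4 ≡ ι (+ 1 / 729)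
[-z]⁴≡1/729 = refl

[-v]⁶≡1/729 : (⊖ v) ^ᴷ 6 ≡ ι (+ 1 / 729)
[-v]⁶≡1/729 = refl

‖log₁₊u+log₁₊v-log₁₊z‖-≤ : ∀ N → ‖ log₁₊ N u ⊕ log₁₊ N v ⊕ ⊖ log₁₊ N z ‖ ≤ fromℕ 20 * ¾ ^ N
‖log₁₊u+log₁₊v-log₁₊z‖-≤ N = subst (λ y → ‖ log₁₊ N u ⊕ log₁₊ N v ⊕ ⊖ log₁₊ N y ‖ ≤ fromℕ 20 * ¾ ^ N) u⊕v⊕u⊗v≡z
  (LogOfProduct.log₁₊-of-product u v (≤-decide ‖ u ‖ ¾) (≤-decide ‖ v ‖ ¾) (≤-decide (‖ u ⊕ v ‖ + ‖ u ⊗ v ‖) ¾) N)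

logSum : ℕ → ℚ[√-3]
logSum n = log₁₊ (12 ℕ.* n) u ⊕ ⊖ log₁₊ (4 ℕ.* n) z ⊕ log₁₊ (6 ℕ.* n) v

‖logSum‖-≤ : ∀ n → ‖ logSum n ‖ ≤ fromℕ 28 * ¾ ^ (4 ℕ.* n)
‖logSum‖-≤ n = begin
  ‖ logSum n ‖
    ≡⟨ cong ‖_‖ (trans (cong₂ (λ a b → log₁₊ a u ⊕ ⊖ log₁₊ K z ⊕ log₁₊ b v) (12n≡4n+8n n) (6n≡4n+2n n))
                       (regroup (log₁₊ (K ℕ.+ 8 ℕ.* n) u) (log₁₊ K z) (log₁₊ (K ℕ.+ 2 ℕ.* n) v) (log₁₊ K u) (log₁₊ K v))) ⟩
  ‖ product ⊕ tailᵤ ⊕ tailᵥ ‖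
    ≤⟨ ‖⊕‖-≤ (product ⊕ tailᵤ) tailᵥ
         (‖⊕‖-≤ product tailᵤ (‖log₁₊u+log₁₊v-log₁₊z‖-≤ K) (‖tail‖-≤ u (8 ℕ.* n) (≤-decide ‖ u ‖ ¾)))
         (‖tail‖-≤ v (2 ℕ.* n) (≤-decide ‖ v ‖ ¾)) ⟩
  fromℕ 20 * ¾ ^ K + ¾ ^ K * fromℕ 4 + ¾ ^ K * fromℕ 4
    ≡⟨ collect (¾ ^ K) ⟩
  fromℕ 28 * ¾ ^ K
    ∎
  where
  open ≤-Reasoning
  K : ℕ
  K = 4 ℕ.* n
  product tailᵤ tailᵥ : ℚ[√-3]
  product = log₁₊ K u ⊕ log₁₊ K v ⊕ ⊖ log₁₊ K z
  tailᵤ = log₁₊ (K ℕ.+ 8 ℕ.* n) u ⊕ ⊖ log₁₊ K u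
  tailᵥ = log₁₊ (K ℕ.+ 2 ℕ.* n) v ⊕ ⊖ log₁₊ K v
  12n≡4n+8n : ∀ n → 12 ℕ.* n ≡ 4 ℕ.* n ℕ.+ 8 ℕ.* n
  12n≡4n+8n = ℕ-Solver.solve-∀
  6n≡4n+2n : ∀ n → 6 ℕ.* n ≡ 4 ℕ.* n ℕ.+ 2 ℕ.* n
  6n≡4n+2n = ℕ-Solver.solve-∀
  regroup : ∀ a c b A B → a ⊕ ⊖ c ⊕ b ≡ (A ⊕ B ⊕ ⊖ c) ⊕ (a ⊕ ⊖ A) ⊕ (b ⊕ ⊖ B)
  regroup a c b A B = solve (a ∷ c ∷ b ∷ A ∷ B ∷ []) ℚ[√-3]-ring
  ‖tail‖-≤ : ∀ x k → ‖ x ‖ ≤ ¾ → ‖ log₁₊ (K ℕ.+ k) x ⊕ ⊖ log₁₊ K x ‖ ≤ ¾ ^ K * fromℕ 4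
  ‖tail‖-≤ x k ‖x‖≤¾ = ≤-trans (log₁₊-tail-≤ K k x 0≤¾ ¾≤1 ‖x‖≤¾)
    (*-monoˡ-≤-nonNeg (¾ ^ K) {{ℚ.nonNegative (^-nonNeg K 0≤¾)}} (geometric-¾-≤ k))
  collect : ∀ P → fromℕ 20 * P + P * fromℕ 4 + P * fromℕ 4 ≡ fromℕ 28 * P
  collect P = solve (P ∷ []) ℚ-ring

im-⊕ : ∀ x y → im (x ⊕ y) ≡ im x + im y
im-⊕ (mk a b) (mk c d) = refl

im-⊖ : ∀ x → im (⊖ x) ≡ - im x
im-⊖ (mk a b) = refl

im-ι⊗ : ∀ s x → im (ι s ⊗ x) ≡ s * im x
im-ι⊗ s x = cong im (ι-⊗ s x)

ι-homo-^ : ∀ c k → ι c ^ᴷ k ≡ ι (c ^ k)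
ι-homo-^ c zero    = refl
ι-homo-^ c (suc k) = trans (cong (ι c ⊗_) (ι-homo-^ c k)) (ι-homo-* c (c ^ k))

^ᴷ-period : ∀ {y c} m → y ^ᴷ m ≡ ι c → ∀ k → y ^ᴷ (m ℕ.* k) ≡ ι (c ^ k)
^ᴷ-period {y} {c} m yᵐ≡c k = begin
  y ^ᴷ (m ℕ.* k)    ≡⟨ ^ᴷ-assocʳ y m k ⟨
  (y ^ᴷ m) ^ᴷ k     ≡⟨ cong (_^ᴷ k) yᵐ≡c ⟩
  ι c ^ᴷ k          ≡⟨ ι-homo-^ c k ⟩
  ι (c ^ k)         ∎
  where open ≡-Reasoning

sumBelow : ℕ → (ℕ → ℚ) → ℚ
sumBelow zero    f = 0ℚ
sumBelow (suc j) f = sumBelow j f + f j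

sumBelow-cong : ∀ {f g} → (∀ i → f i ≡ g i) → ∀ j → sumBelow j f ≡ sumBelow j g
sumBelow-cong f≡g zero    = refl
sumBelow-cong f≡g (suc j) = cong₂ _+_ (sumBelow-cong f≡g j) (f≡g j)

block : ℕ → ℕ → ℚ[√-3] → ℚ[√-3]
block zero    b x = 𝟘
block (suc j) b x = block j b x ⊕ logTerm (j ℕ.+ b) x

log₁₊-split : ∀ j b x → log₁₊ (j ℕ.+ b) x ≡ log₁₊ b x ⊕ block j b x
log₁₊-split zero    b x = sym (⊕-identityʳ (log₁₊ b x))
log₁₊-split (suc j) b x = trans (cong (_⊕ logTerm (j ℕ.+ b) x) (log₁₊-split j b x))
                                (⊕-assoc (log₁₊ b x) (block j b x) (logTerm (j ℕ.+ b) x))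

im-logTerm : ∀ i b x {Q} → (⊖ x) ^ᴷ b ≡ ι Q →
             im (logTerm (i ℕ.+ b) x) ≡ - (1/[1+ i ℕ.+ b ] * (Q * im ((⊖ x) ^ᴷ suc i)))
im-logTerm i b x {Q} [-x]ᵇ≡Q = begin
  im (⊖ (ι 1/[1+ i ℕ.+ b ] ⊗ (⊖ x) ^ᴷ (suc i ℕ.+ b)))          ≡⟨ im-⊖ (ι 1/[1+ i ℕ.+ b ] ⊗ (⊖ x) ^ᴷ (suc i ℕ.+ b)) ⟩
  - im (ι 1/[1+ i ℕ.+ b ] ⊗ (⊖ x) ^ᴷ (suc i ℕ.+ b))            ≡⟨ cong -_ (im-ι⊗ 1/[1+ i ℕ.+ b ] ((⊖ x) ^ᴷ (suc i ℕ.+ b))) ⟩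
  - (1/[1+ i ℕ.+ b ] * im ((⊖ x) ^ᴷ (suc i ℕ.+ b)))            ≡⟨ cong (λ y → - (1/[1+ i ℕ.+ b ] * im y)) [-x]ⁱ⁺¹⁺ᵇ ⟩
  - (1/[1+ i ℕ.+ b ] * im (ι Q ⊗ (⊖ x) ^ᴷ suc i))              ≡⟨ cong (λ q → - (1/[1+ i ℕ.+ b ] * q)) (im-ι⊗ Q ((⊖ x) ^ᴷ suc i)) ⟩
  - (1/[1+ i ℕ.+ b ] * (Q * im ((⊖ x) ^ᴷ suc i)))              ∎
  where
  open ≡-Reasoning
  [-x]ⁱ⁺¹⁺ᵇ : (⊖ x) ^ᴷ (suc i ℕ.+ b) ≡ ι Q ⊗ (⊖ x) ^ᴷ suc i
  [-x]ⁱ⁺¹⁺ᵇ = trans (^ᴷ-homo-* (⊖ x) (suc i) b)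
                    (trans (cong ((⊖ x) ^ᴷ suc i ⊗_) [-x]ᵇ≡Q) (⊗-comm ((⊖ x) ^ᴷ suc i) (ι Q)))

im-block : ∀ j b x {Q} → (⊖ x) ^ᴷ b ≡ ι Q →
           im (block j b x) ≡ sumBelow j (λ i → - (1/[1+ i ℕ.+ b ] * (Q * im ((⊖ x) ^ᴷ suc i))))
im-block zero    b x [-x]ᵇ≡Q = refl
im-block (suc j) b x [-x]ᵇ≡Q = trans (im-⊕ (block j b x) (logTerm (j ℕ.+ b) x))
  (cong₂ _+_ (im-block j b x [-x]ᵇ≡Q) (im-logTerm j b x [-x]ᵇ≡Q))

logBlock : ℕ → ℚ[√-3]
logBlock k = block 12 (12 ℕ.* k) u ⊕ ⊖ block 4 (4 ℕ.* k) z ⊕ block 6 (6 ℕ.* k) v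

logSum-suc : ∀ k → logSum (suc k) ≡ logSum k ⊕ logBlock k
logSum-suc k = trans
  (cong₃ (λ a b c → a ⊕ ⊖ b ⊕ c) (log₁₊-split-period 12 u) (log₁₊-split-period 4 z) (log₁₊-split-period 6 v))
  (regroup (log₁₊ (12 ℕ.* k) u) (block 12 (12 ℕ.* k) u) (log₁₊ (4 ℕ.* k) z) (block 4 (4 ℕ.* k) z)
           (log₁₊ (6 ℕ.* k) v) (block 6 (6 ℕ.* k) v))
  where
  log₁₊-split-period : ∀ m x → log₁₊ (m ℕ.* suc k) x ≡ log₁₊ (m ℕ.* k) x ⊕ block m (m ℕ.* k) x
  log₁₊-split-period m x = trans (cong (λ n → log₁₊ n x) (ℕ.*-suc m k)) (log₁₊-split m (m ℕ.* k) x)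
  regroup : ∀ a A b B c C → (a ⊕ A) ⊕ ⊖ (b ⊕ B) ⊕ (c ⊕ C) ≡ (a ⊕ ⊖ b ⊕ c) ⊕ (A ⊕ ⊖ B ⊕ C)
  regroup a A b B c C = solve (a ∷ A ∷ b ∷ B ∷ c ∷ C ∷ []) ℚ[√-3]-ring

1/-unique : ∀ P .{{_ : ℕ.NonZero P}} x → x * fromℕ P ≡ 1ℚ → + 1 / P ≡ x
1/-unique (suc P) x x*P≡1 = begin
  1/[1+ P ]                          ≡⟨ *-identityˡ 1/[1+ P ] ⟨
  1ℚ * 1/[1+ P ]                     ≡⟨ cong (_* 1/[1+ P ]) x*P≡1 ⟨
  x * fromℕ (suc P) * 1/[1+ P ]      ≡⟨ *-assoc x (fromℕ (suc P)) 1/[1+ P ] ⟩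
  x * (fromℕ (suc P) * 1/[1+ P ])    ≡⟨ cong (x *_) (trans (*-comm (fromℕ (suc P)) 1/[1+ P ]) (1/[1+n]*[1+n] P)) ⟩
  x * 1ℚ                             ≡⟨ *-identityʳ x ⟩
  x                                  ∎
  where open ≡-Reasoning

1/3⁶ᵏ≡[1/729]ᵏ : ∀ k → (+ 1 / (3 ℕ.^ (6 ℕ.* k))) {{ℕ.m^n≢0 3 (6 ℕ.* k)}} ≡ (+ 1 / 729) ^ k
1/3⁶ᵏ≡[1/729]ᵏ k = 1/-unique (3 ℕ.^ (6 ℕ.* k)) {{ℕ.m^n≢0 3 (6 ℕ.* k)}} ((+ 1 / 729) ^ k) (inverse k)
  where
  open ≡-Reasoning
  inverse : ∀ k → (+ 1 / 729) ^ k * fromℕ (3 ℕ.^ (6 ℕ.* k)) ≡ 1ℚ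
  inverse zero    = refl
  inverse (suc k) = begin
    (+ 1 / 729 * Q) * fromℕ (3 ℕ.^ (6 ℕ.* suc k))
      ≡⟨ cong (λ n → (+ 1 / 729 * Q) * fromℕ n) (trans (cong (3 ℕ.^_) (ℕ.*-suc 6 k)) (ℕ.^-distribˡ-+-* 3 6 (6 ℕ.* k))) ⟩
    (+ 1 / 729 * Q) * fromℕ (729 ℕ.* 3 ℕ.^ (6 ℕ.* k))
      ≡⟨ cong ((+ 1 / 729 * Q) *_) (fromℕ-* 729 (3 ℕ.^ (6 ℕ.* k))) ⟩
    (+ 1 / 729 * Q) * (fromℕ 729 * fromℕ (3 ℕ.^ (6 ℕ.* k)))
      ≡⟨ swap (+ 1 / 729) Q (fromℕ 729) (fromℕ (3 ℕ.^ (6 ℕ.* k))) ⟩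
    (+ 1 / 729 * fromℕ 729) * (Q * fromℕ (3 ℕ.^ (6 ℕ.* k)))
      ≡⟨ cong ((+ 1 / 729 * fromℕ 729) *_) (inverse k) ⟩
    1ℚ
      ∎
    where
    Q : ℚ
    Q = (+ 1 / 729) ^ k
    swap : ∀ a b c d → (a * b) * (c * d) ≡ (a * c) * (b * d)
    swap a b c d = solve (a ∷ b ∷ c ∷ d ∷ []) ℚ-ring

bracketOf : ℚ → ℚ → ℚ → ℚ → ℚ → ℚ → ℚ → ℚ → ℚ → ℚ → ℚ
bracketOf t₁ t₂ t₃ t₄ t₅ t₇ t₈ t₉ t₁₀ t₁₁ = t₁ - t₂ - t₃ - t₄ + t₅ - t₇ + t₈ + t₉ + t₁₀ - t₁₁

bracketOf-cong : ∀ {t₁ t₂ t₃ t₄ t₅ t₇ t₈ t₉ t₁₀ t₁₁ s₁ s₂ s₃ s₄ s₅ s₇ s₈ s₉ s₁₀ s₁₁} →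
  t₁ ≡ s₁ → t₂ ≡ s₂ → t₃ ≡ s₃ → t₄ ≡ s₄ → t₅ ≡ s₅ → t₇ ≡ s₇ → t₈ ≡ s₈ → t₉ ≡ s₉ → t₁₀ ≡ s₁₀ → t₁₁ ≡ s₁₁ →
  bracketOf t₁ t₂ t₃ t₄ t₅ t₇ t₈ t₉ t₁₀ t₁₁ ≡ bracketOf s₁ s₂ s₃ s₄ s₅ s₇ s₈ s₉ s₁₀ s₁₁
bracketOf-cong refl refl refl refl refl refl refl refl refl refl = refl

im-logBlock : ∀ k → im (logBlock k) ≡
    sumBelow 12 (λ i → - (1/[1+ i ℕ.+ 12 ℕ.* k ] * ((+ 1 / 729) ^ k * im ((⊖ u) ^ᴷ suc i))))
  + - sumBelow 4 (λ i → - ((fromℕ 3 * 1/[1+ 3 ℕ.* i ℕ.+ 2 ℕ.+ 12 ℕ.* k ]) * ((+ 1 / 729) ^ k * im ((⊖ z) ^ᴷ suc i))))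
  + sumBelow 6 (λ i → - ((fromℕ 2 * 1/[1+ 2 ℕ.* i ℕ.+ 1 ℕ.+ 12 ℕ.* k ]) * ((+ 1 / 729) ^ k * im ((⊖ v) ^ᴷ suc i))))
im-logBlock k = begin
  im (logBlock k)
    ≡⟨ im-⊕ (block 12 (12 ℕ.* k) u ⊕ ⊖ block 4 (4 ℕ.* k) z) (block 6 (6 ℕ.* k) v) ⟩
  im (block 12 (12 ℕ.* k) u ⊕ ⊖ block 4 (4 ℕ.* k) z) + im (block 6 (6 ℕ.* k) v)
    ≡⟨ cong (_+ im (block 6 (6 ℕ.* k) v))
            (trans (im-⊕ (block 12 (12 ℕ.* k) u) (⊖ block 4 (4 ℕ.* k) z))
                   (cong (λ t → im (block 12 (12 ℕ.* k) u) + t) (im-⊖ (block 4 (4 ℕ.* k) z)))) ⟩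
  im (block 12 (12 ℕ.* k) u) + - im (block 4 (4 ℕ.* k) z) + im (block 6 (6 ℕ.* k) v)
    ≡⟨ cong₃ (λ a b c → a + - b + c)
         (im-block 12 (12 ℕ.* k) u (^ᴷ-period 12 [-u]¹²≡1/729 k))
         (trans (im-block 4 (4 ℕ.* k) z (^ᴷ-period 4 [-z]⁴≡1/729 k)) (sumBelow-cong (rescale 3 2 4 z ([3i+3+12k] k)) 4))
         (trans (im-block 6 (6 ℕ.* k) v (^ᴷ-period 6 [-v]⁶≡1/729 k)) (sumBelow-cong (rescale 2 1 6 v ([2i+2+12k] k)) 6)) ⟩
  _
    ∎
  where
  open ≡-Reasoning
  [3i+3+12k] : ∀ k i → 3 ℕ.* suc (i ℕ.+ 4 ℕ.* k) ≡ suc (3 ℕ.* i ℕ.+ 2 ℕ.+ 12 ℕ.* k)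
  [3i+3+12k] = ℕ-Solver.solve-∀
  [2i+2+12k] : ∀ k i → 2 ℕ.* suc (i ℕ.+ 6 ℕ.* k) ≡ suc (2 ℕ.* i ℕ.+ 1 ℕ.+ 12 ℕ.* k)
  [2i+2+12k] = ℕ-Solver.solve-∀
  rescale : ∀ t c m x → (∀ i → t ℕ.* suc (i ℕ.+ m ℕ.* k) ≡ suc (t ℕ.* i ℕ.+ c ℕ.+ 12 ℕ.* k)) → ∀ i →
            - (1/[1+ i ℕ.+ m ℕ.* k ] * ((+ 1 / 729) ^ k * im ((⊖ x) ^ᴷ suc i)))
          ≡ - ((fromℕ t * 1/[1+ t ℕ.* i ℕ.+ c ℕ.+ 12 ℕ.* k ]) * ((+ 1 / 729) ^ k * im ((⊖ x) ^ᴷ suc i)))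
  rescale t c m x eq i = cong (λ r → - (r * ((+ 1 / 729) ^ k * im ((⊖ x) ^ᴷ suc i))))
                              (1/[1+]-rescale t (i ℕ.+ m ℕ.* k) (t ℕ.* i ℕ.+ c ℕ.+ 12 ℕ.* k) (eq i))


-- Both sides are linear in the reciprocals rⱼ = 1/(12k + j); the identity compares their coefficients.
coefficients : ∀ Q r₁ r₂ r₃ r₄ r₅ r₆ r₇ r₈ r₉ r₁₀ r₁₁ r₁₂ →
  Q * (fromℕ 243 * r₁ - fromℕ 243 * r₂ - fromℕ 324 * r₃ - fromℕ 81 * r₄ + fromℕ 27 * r₅
       - fromℕ 9 * r₇ + fromℕ 9 * r₈ + fromℕ 12 * r₉ + fromℕ 3 * r₁₀ - fromℕ 1 * r₁₁)
  ≡ fromℕ 729 * ((0ℚ + - (r₁ * (Q * im ((⊖ u) ^ᴷ 1)))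
                    + - (r₂ * (Q * im ((⊖ u) ^ᴷ 2)))
                    + - (r₃ * (Q * im ((⊖ u) ^ᴷ 3)))
                    + - (r₄ * (Q * im ((⊖ u) ^ᴷ 4)))
                    + - (r₅ * (Q * im ((⊖ u) ^ᴷ 5)))
                    + - (r₆ * (Q * im ((⊖ u) ^ᴷ 6)))
                    + - (r₇ * (Q * im ((⊖ u) ^ᴷ 7)))
                    + - (r₈ * (Q * im ((⊖ u) ^ᴷ 8)))
                    + - (r₉ * (Q * im ((⊖ u) ^ᴷ 9)))
                    + - (r₁₀ * (Q * im ((⊖ u) ^ᴷ 10)))
                    + - (r₁₁ * (Q * im ((⊖ u) ^ᴷ 11)))
                    + - (r₁₂ * (Q * im ((⊖ u) ^ᴷ 12))))
                 + - (0ℚ + - ((fromℕ 3 * r₃) * (Q * im ((⊖ z) ^ᴷ 1)))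
                       + - ((fromℕ 3 * r₆) * (Q * im ((⊖ z) ^ᴷ 2)))
                       + - ((fromℕ 3 * r₉) * (Q * im ((⊖ z) ^ᴷ 3)))
                       + - ((fromℕ 3 * r₁₂) * (Q * im ((⊖ z) ^ᴷ 4))))
                 + (0ℚ + - ((fromℕ 2 * r₂) * (Q * im ((⊖ v) ^ᴷ 1)))
                    + - ((fromℕ 2 * r₄) * (Q * im ((⊖ v) ^ᴷ 2)))
                    + - ((fromℕ 2 * r₆) * (Q * im ((⊖ v) ^ᴷ 3)))
                    + - ((fromℕ 2 * r₈) * (Q * im ((⊖ v) ^ᴷ 4)))
                    + - ((fromℕ 2 * r₁₀) * (Q * im ((⊖ v) ^ᴷ 5)))
                    + - ((fromℕ 2 * r₁₂) * (Q * im ((⊖ v) ^ᴷ 6)))))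
coefficients Q r₁ r₂ r₃ r₄ r₅ r₆ r₇ r₈ r₉ r₁₀ r₁₁ r₁₂ = solve (Q ∷ r₁ ∷ r₂ ∷ r₃ ∷ r₄ ∷ r₅ ∷ r₆ ∷ r₇ ∷ r₈ ∷ r₉ ∷ r₁₀ ∷ r₁₁ ∷ r₁₂ ∷ []) ℚ-ring

term-as-im : ∀ k → term k ≡ fromℕ 729 * im (logBlock k)
term-as-im k = trans
  (cong₂ _*_ (1/3⁶ᵏ≡[1/729]ᵏ k)
    (bracketOf-cong (/-as-* 243 (0 ℕ.+ b)) (/-as-* 243 (1 ℕ.+ b)) (/-as-* 324 (2 ℕ.+ b)) (/-as-* 81 (3 ℕ.+ b))
                    (/-as-* 27 (4 ℕ.+ b)) (/-as-* 9 (6 ℕ.+ b)) (/-as-* 9 (7 ℕ.+ b)) (/-as-* 12 (8 ℕ.+ b))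
                    (/-as-* 3 (9 ℕ.+ b)) (/-as-* 1 (10 ℕ.+ b))))
  (trans (coefficients ((+ 1 / 729) ^ k) (r 0) (r 1) (r 2) (r 3) (r 4) (r 5) (r 6) (r 7) (r 8) (r 9) (r 10) (r 11))
         (cong (fromℕ 729 *_) (sym (im-logBlock k))))
  where
  b : ℕ
  b = 12 ℕ.* k
  r : ℕ → ℚ
  r j = 1/[1+ j ℕ.+ b ]

partialSums-as-im : ∀ (s : ℕ → ℚ) → s 0 ≡ 0ℚ → (∀ n → s (suc n) ≡ s n + term n) → ∀ n → s n ≡ fromℕ 729 * im (logSum n)
partialSums-as-im s s₀≡0 sₙ₊₁≡sₙ+aₙ zero    = s₀≡0
partialSums-as-im s s₀≡0 sₙ₊₁≡sₙ+aₙ (suc n) = begin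
  s (suc n)                                               ≡⟨ sₙ₊₁≡sₙ+aₙ n ⟩
  s n + term n                                            ≡⟨ cong₂ _+_ (partialSums-as-im s s₀≡0 sₙ₊₁≡sₙ+aₙ n) (term-as-im n) ⟩
  fromℕ 729 * im (logSum n) + fromℕ 729 * im (logBlock n) ≡⟨ *-distribˡ-+ (fromℕ 729) (im (logSum n)) (im (logBlock n)) ⟨
  fromℕ 729 * (im (logSum n) + im (logBlock n))           ≡⟨ cong (fromℕ 729 *_) (im-⊕ (logSum n) (logBlock n)) ⟨
  fromℕ 729 * im (logSum n ⊕ logBlock n)                  ≡⟨ cong (λ x → fromℕ 729 * im x) (logSum-suc n) ⟨
  fromℕ 729 * im (logSum (suc n))                         ∎
  where open ≡-Reasoning

-- The partial sums in SeriesSumsTo are local to its definition and can only be found by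
-- unification, which needs ∣_∣ and _+_ abstracted to rigid variables.
seriesSumsTo : ∀ a L →
  (∀ (s : ℕ → ℚ) → s 0 ≡ 0ℚ → (∀ n → s (suc n) ≡ s n + a n) →
     ∀ ε → 0ℚ < ε → ∃ λ N → ∀ n → n ℕ.≥ N → ∣ s n + - L ∣ < ε) →
  SeriesSumsTo a L
seriesSumsTo a L partialSums→L ε 0<ε with ∣_∣ | _+_ in +≡add
... | abs | add = partialSums→L _ refl (λ n → cong-app (cong-app +≡add _) (a n)) ε 0<ε

¾^n-≤ : ∀ n → ¾ ^ n ≤ fromℕ 3 * 1/[1+ n ]
¾^n-≤ n = begin
  ¾ ^ n                                        ≡⟨ *-identityʳ (¾ ^ n) ⟨
  ¾ ^ n * 1ℚ                                   ≡⟨ cong (¾ ^ n *_) (trans (*-comm (fromℕ (3 ℕ.+ n)) 1/[1+ 2 ℕ.+ n ]) (1/[1+n]*[1+n] (2 ℕ.+ n))) ⟨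
  ¾ ^ n * (fromℕ (3 ℕ.+ n) * 1/[1+ 2 ℕ.+ n ])  ≡⟨ *-assoc (¾ ^ n) (fromℕ (3 ℕ.+ n)) 1/[1+ 2 ℕ.+ n ] ⟨
  ¾ ^ n * fromℕ (3 ℕ.+ n) * 1/[1+ 2 ℕ.+ n ]    ≤⟨ *-mono-≤-nonNeg (*-nonNeg (^-nonNeg n 0≤¾) (fromℕ-nonNeg (3 ℕ.+ n))) (1/[1+]-nonNeg (2 ℕ.+ n))
                                                    (¾^n*[3+n]≤3 n) (1/[1+]-antitone (ℕ.m≤n+m n 2)) ⟩
  fromℕ 3 * 1/[1+ n ]                          ∎
  where
  open ≤-Reasoning
  ¾^n*[3+n]≤3 : ∀ n → ¾ ^ n * fromℕ (3 ℕ.+ n) ≤ fromℕ 3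
  ¾^n*[3+n]≤3 zero    = ≤-refl
  ¾^n*[3+n]≤3 (suc n) = begin
    ¾ * P * fromℕ (3 ℕ.+ suc n)                        ≡⟨ cong (λ m → ¾ * P * m) (trans (fromℕ-suc (3 ℕ.+ n)) (cong (_+ 1ℚ) (fromℕ-+ 3 n))) ⟩
    ¾ * P * (fromℕ 3 + y + 1ℚ)                         ≤⟨ ≤-+ʳ (*-nonNeg (≤-decide 0ℚ (+ 1 / 4)) (*-nonNeg (^-nonNeg n 0≤¾) (fromℕ-nonNeg n))) ⟩
    ¾ * P * (fromℕ 3 + y + 1ℚ) + + 1 / 4 * (P * y)     ≡⟨ rearrange P y ⟩
    P * (fromℕ 3 + y)                                  ≡⟨ cong (P *_) (fromℕ-+ 3 n) ⟨
    P * fromℕ (3 ℕ.+ n)                                ≤⟨ ¾^n*[3+n]≤3 n ⟩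
    fromℕ 3                                            ∎
    where
    P y : ℚ
    P = ¾ ^ n
    y = fromℕ n
    rearrange : ∀ P y → ¾ * P * (fromℕ 3 + y + 1ℚ) + + 1 / 4 * (P * y) ≡ P * (fromℕ 3 + y)
    rearrange P y = solve (P ∷ y ∷ []) ℚ-ring

∣partialSum∣-≤ : ∀ (s : ℕ → ℚ) → s 0 ≡ 0ℚ → (∀ n → s (suc n) ≡ s n + term n) →
                 ∀ n → ∣ s n ∣ ≤ fromℕ 34992 * 1/[1+ n ]
∣partialSum∣-≤ s s₀≡0 sₙ₊₁≡sₙ+aₙ n = begin
  ∣ s n ∣
    ≡⟨ cong ∣_∣ (partialSums-as-im s s₀≡0 sₙ₊₁≡sₙ+aₙ n) ⟩
  ∣ fromℕ 729 * im (logSum n) ∣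
    ≡⟨ trans (∣p*q∣≡∣p∣*∣q∣ (fromℕ 729) (im (logSum n))) (cong (_* ∣ im (logSum n) ∣) (0≤p⇒∣p∣≡p (fromℕ-nonNeg 729))) ⟩
  fromℕ 729 * ∣ im (logSum n) ∣
    ≤⟨ *-monoˡ-≤-nonNeg (fromℕ 729) (≤-trans (∣im∣-≤ (logSum n))
         (*-monoˡ-≤-nonNeg (+ 4 / 7) (≤-trans (‖logSum‖-≤ n)
           (*-monoˡ-≤-nonNeg (fromℕ 28) (≤-trans (^-antitoneʳ 0≤¾ ¾≤1 (ℕ.m≤n*m n 4)) (¾^n-≤ n)))))) ⟩
  fromℕ 729 * (+ 4 / 7 * (fromℕ 28 * (fromℕ 3 * 1/[1+ n ])))
    ≡⟨ collect 1/[1+ n ] ⟩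
  fromℕ 34992 * 1/[1+ n ]
    ∎
  where
  open ≤-Reasoning
  collect : ∀ r → fromℕ 729 * (+ 4 / 7 * (fromℕ 28 * (fromℕ 3 * r))) ≡ fromℕ 34992 * r
  collect r = solve (r ∷ []) ℚ-ring

partialSums→0 : ∀ (s : ℕ → ℚ) → s 0 ≡ 0ℚ → (∀ n → s (suc n) ≡ s n + term n) →
                ∀ ε → 0ℚ < ε → ∃ λ N → ∀ n → n ℕ.≥ N → ∣ s n + - 0ℚ ∣ < ε
partialSums→0 s s₀≡0 sₙ₊₁≡sₙ+aₙ ε 0<ε = N , λ n n≥N → begin-strict
  ∣ s n + - 0ℚ ∣                ≡⟨ cong ∣_∣ (+-identityʳ (s n)) ⟩
  ∣ s n ∣                       ≤⟨ ∣partialSum∣-≤ s s₀≡0 sₙ₊₁≡sₙ+aₙ n ⟩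
  fromℕ 34992 * 1/[1+ n ]       ≤⟨ *-monoˡ-≤-nonNeg (fromℕ 34992) (1/[1+]-antitone n≥N) ⟩
  fromℕ 34992 * 1/[1+ N ]       <⟨ proj₂ (archimedean 34992 ε 0<ε) ⟩
  ε                             ∎
  where
  open ≤-Reasoning
  N : ℕ
  N = proj₁ (archimedean 34992 ε 0<ε)

mainTheorem8 : SeriesSumsTo term 0ℚ
mainTheorem8 = seriesSumsTo term 0ℚ partialSums→0
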